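{- Let $f(t)$ be a delta series with complex coefficients and let $\bar f(t)$ be its compositional inverse. For all integers $n \ge k \ge 0$, \[ S_{1}(n,k; f(t))=\sum_{j=0}^{n-k}\binom{n+j-1}{n+j-k}\binom{2n-k}{n-k-j}(-1)^{j}\big(\bar{f}^{\prime}(0)\big)^{ -n-j}S_{2}(n-k+j,j; f(t)). \]
   Context: All series are formal power series in $t$ over $\mathbb{C}$. A delta series is a formal power series $f(t)$ with $f(0)=0$, $f'(0)\neq0$; its compositional inverse $\bar f(t)$ is again a delta series, so $\bar f'(0)\ne0$. The Stirling numbers of the second kind associated with $f$ are defined by $\frac{1}{k!}\big(e^{\bar f(t)}-1\big)^k=\sum_{n\ge k}S_2(n,k;f(t))\frac{t^n}{n!}$ for $k\ge0$. Let $\bar e_{f(t)}(t)$ be the compositional inverse of the delta series $e^{\bar f(t)}-1$ (equivalently $\bar e_{f(t)}(t)=f(\log(1+t))$); the Stirling numbers of the first kind associated with $f$ are defined by $\frac{1}{k!}\big(\bar e_{f(t)}(t)\big)^k=\sum_{n\ge k}S_1(n,k;f(t))\frac{t^n}{n!}$ for $k\ge0$. The binomial coefficient $\binom{ -1}{0}$ (occurring for $n=k=0$) equals $1$. -}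

module Defs where

open import Level using (Level; _⊔_)
open import Data.Nat as ℕ using (ℕ; zero; suc; _∸_; _≤_)
open import Data.Nat.Combinatorics using (_C_)
open import Data.Product using (_×_)
open import Relation.Nullary using (¬_)
open import Algebra.Bundles using (CommutativeRing)

-- A field of characteristic zero (ℂ is an instance).
ringFromℕ : ∀ {c ℓ} (R : CommutativeRing c ℓ) → ℕ → CommutativeRing.Carrier R
ringFromℕ R zero    = CommutativeRing.0# R
ringFromℕ R (suc n) = CommutativeRing._+_ R (CommutativeRing.1# R) (ringFromℕ R n)

record CharZeroField (c ℓ : Level) : Set (Level.suc (c ⊔ ℓ)) where
  field
    ring      : CommutativeRing c ℓ
    inv       : CommutativeRing.Carrier ring → CommutativeRing.Carrier ring
    inv-law   : ∀ x → ¬ (CommutativeRing._≈_ ring x (CommutativeRing.0# ring)) →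
                CommutativeRing._≈_ ring (CommutativeRing._*_ ring x (inv x)) (CommutativeRing.1# ring)
    char-zero : ∀ n → ¬ (CommutativeRing._≈_ ring (ringFromℕ ring (suc n)) (CommutativeRing.0# ring))
  open CommutativeRing ring public hiding (ring)
  fromℕ : ℕ → Carrier
  fromℕ = ringFromℕ ring

module PowerSeries {c ℓ} (F : CharZeroField c ℓ) where
  open CharZeroField F

  PS : Set c
  PS = ℕ → Carrier

  _^_ : Carrier → ℕ → Carrier
  x ^ zero  = 1#
  x ^ suc n = x * (x ^ n)

  Σ≤ : ℕ → (ℕ → Carrier) → Carrier
  Σ≤ zero    g = g 0
  Σ≤ (suc n) g = Σ≤ n g + g (suc n)

  fact : ℕ → Carrier
  fact n = fromℕ (n ℕ.!)

  binom : ℕ → ℕ → Carrier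
  binom n k = fromℕ (n C k)

  _≋_ : PS → PS → Set ℓ
  a ≋ b = ∀ n → a n ≈ b n

  _·_ : PS → PS → PS
  (a · b) n = Σ≤ n (λ i → a i * b (n ∸ i))

  pow : PS → ℕ → PS
  pow a zero    = λ n → 1#-coeff n
    where
    1#-coeff : ℕ → Carrier
    1#-coeff zero    = 1#
    1#-coeff (suc _) = 0#
  pow a (suc k) = a · pow a k

  X : PS
  X zero          = 0#
  X (suc zero)    = 1#
  X (suc (suc _)) = 0#

  -- composition a(b(t)), for b with b(0) = 0 (finite sum then exact)
  _∘ₛ_ : PS → PS → PS
  (a ∘ₛ b) n = Σ≤ n (λ k → a k * pow b k n)

  IsDelta : PS → Set ℓ
  IsDelta f = (f 0 ≈ 0#) × ¬ (f 1 ≈ 0#)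

  IsCompInverse : PS → PS → Set ℓ
  IsCompInverse f g = ((f ∘ₛ g) ≋ X) × ((g ∘ₛ f) ≋ X)

  expm1 : PS
  expm1 zero    = 0#
  expm1 (suc k) = inv (fact (suc k))

  expm1∘ : PS → PS
  expm1∘ g = expm1 ∘ₛ g

  -- (1/k!) h(t)^k = Σ_n S(n,k) t^n/n!  ⇒  S(n,k) = n! (1/k!) [t^n] h^k
  assocStirling : PS → ℕ → ℕ → Carrier
  assocStirling h n k = fact n * (inv (fact k) * pow h k n)

  -- S₂(n,k; f) given the compositional inverse fbar of f
  S₂ : (fbar : PS) → ℕ → ℕ → Carrier
  S₂ fbar = assocStirling (expm1∘ fbar)

  -- S₁(n,k; f) given ebar, the compositional inverse of e^{fbar(t)} - 1
  S₁ : (ebar : PS) → ℕ → ℕ → Carrier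
  S₁ ebar = assocStirling ebar

-- field operations with the field's addition renamed (to avoid clashing
-- with ℕ addition in index expressions)
module FieldOps {c ℓ} (F : CharZeroField c ℓ) where
  open CharZeroField F public renaming (_+_ to _+F_)

-- Put h = e^{f̄} − 1, so that ē is the compositional inverse of h, S₁(n,k) = (n!/k!)[tⁿ]ēᵏ and
-- S₂(n,k) = (n!/k!)[tⁿ]hᵏ.  Lagrange inversion, n[tⁿ]ēᵏ = k[tⁿ⁻ᵏ]ψⁿ with ψ = t/h, follows from the
-- residue identity [tⁿ](ψⁿ·θ(hʲ)) = n·δⱼₙ, where θ = t d/dt.  With a = f̄′(0) write h = a·t·v and
-- v = 1 + u; then ψ = a⁻¹/(1 + u), so ψⁿ = a⁻ⁿ Σᵢ (−1)ⁱ C(n−1+i, i) (v − 1)ⁱ.  Expanding (v − 1)ⁱ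
-- binomially, using [tᵐ]vʲ = a⁻ʲ[t^{m+j}]hʲ, and collapsing the inner sum by trinomial revision and
-- the hockey-stick identity expresses [tᵐ]ψⁿ through the S₂(m+j, j); the prefactors finally combine
-- because (n−1)!·C(n−1+j, j)·j! = (k−1)!·C(n−1+j, m+j)·(m+j)! = (n−1+j)!  (m = n − k).
module Submission where

open import Defs
open import Data.Nat using (ℕ; zero; suc; z≤n; s≤s; _+_; _∸_; _≤_; _<_)
import Data.Nat as Nat
import Data.Nat.Properties as ℕₚ
open import Data.Nat.Combinatorics using (_C_; nCn≡1; nCk+nC[k+1]≡[n+1]C[k+1]; k>n⇒nCk≡0)
open import Data.Nat.Tactic.RingSolver using (solve-∀)
open import Data.Fin using (toℕ)
open import Data.Product using (Σ; _,_)
open import Data.Sum using (inj₁; inj₂)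
open import Data.Empty using (⊥-elim)
import Relation.Binary.PropositionalEquality as ≡
open ≡ using (_≡_; _≢_)
open import Relation.Binary.Structures using (IsEquivalence)
open import Algebra.Bundles using (CommutativeRing; CommutativeSemiring)
open import Algebra.Structures using (IsCommutativeMonoid)
import Algebra.Structures.Biased as Biased
import Algebra.Solver.Ring.NaturalCoefficients.Default as NatCoeffSolver
import Algebra.Properties.CommutativeSemiring.Binomial as BinomialTheorem

module Binomial where
  open Nat using (_*_; _!)
  open ℕₚ using (+-comm; +-assoc; m+n∸m≡n; m≤m+n; *-cancelʳ-≡; m*n≢0; _!≢0; _!*_!≢0)
  open import Data.Nat.Combinatorics using (nCk≡n!/k![n-k]!; k![n∸k]!∣n!)
  open import Data.Nat.DivMod using (m/n*n≡m)
  open ≡ using (refl; cong; subst; sym; trans)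
  open ≡.≡-Reasoning

  nCa*a!*b!≡n! : ∀ a b {n} → a + b ≡ n → (n C a) * (a ! * b !) ≡ n !
  nCa*a!*b!≡n! a b refl =
    subst (λ d → ((a + b) C a) * (a ! * d !) ≡ (a + b) !) (m+n∸m≡n a b) C*factorials
    where
    a≤a+b = m≤m+n a b
    C*factorials : ((a + b) C a) * (a ! * (a + b ∸ a) !) ≡ (a + b) !
    C*factorials = trans (cong (_* (a ! * (a + b ∸ a) !)) (nCk≡n!/k![n-k]! a≤a+b))
                         (m/n*n≡m {{a !* (a + b ∸ a) !≢0}} (k![n∸k]!∣n! a≤a+b))

  trinomial-revision : ∀ n j p →
    ((n + (j + p)) C (j + p)) * ((j + p) C j) ≡ ((n + j) C j) * ((n + j + p) C p)
  trinomial-revision n j p =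
    *-cancelʳ-≡ _ _ (j ! * p ! * n !) {{m*n≢0 (j ! * p !) (n !) {{j !* p !≢0}} {{n !≢0}}}} (begin
      A * B * (j ! * p ! * n !)         ≡⟨ regroupˡ A B (j !) (p !) (n !) ⟩
      A * ((B * (j ! * p !)) * n !)     ≡⟨ cong (λ z → A * (z * n !)) (nCa*a!*b!≡n! j p refl) ⟩
      A * ((j + p) ! * n !)             ≡⟨ nCa*a!*b!≡n! (j + p) n (+-comm (j + p) n) ⟩
      (n + (j + p)) !                   ≡⟨ cong _! (+-assoc n j p) ⟨
      (n + j + p) !                     ≡⟨ nCa*a!*b!≡n! p (n + j) (+-comm p (n + j)) ⟨
      D * (p ! * (n + j) !)             ≡⟨ cong (λ z → D * (p ! * z)) (nCa*a!*b!≡n! j n (+-comm j n)) ⟨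
      D * (p ! * (C′ * (j ! * n !)))    ≡⟨ regroupʳ C′ D (j !) (p !) (n !) ⟩
      C′ * D * (j ! * p ! * n !)        ∎)
    where
    A = (n + (j + p)) C (j + p)
    B = (j + p) C j
    C′ = (n + j) C j
    D = (n + j + p) C p
    regroupˡ : ∀ a b x y z → a * b * (x * y * z) ≡ a * ((b * (x * y)) * z)
    regroupˡ = solve-∀
    regroupʳ : ∀ c d x y z → d * (y * (c * (x * z))) ≡ c * d * (x * y * z)
    regroupʳ = solve-∀

  [k+m]!*[k+m+j]Cj*j!≡k!*[k+m+j]C[m+j]*[m+j]! : ∀ k m j →
    (k + m) ! * ((k + m + j) C j) * j ! ≡ k ! * (((k + m + j) C (m + j)) * (m + j) !)
  [k+m]!*[k+m+j]Cj*j!≡k!*[k+m+j]C[m+j]*[m+j]! k m j = begin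
    (k + m) ! * (N C j) * j !             ≡⟨ rotate ((k + m) !) (N C j) (j !) ⟩
    (N C j) * (j ! * (k + m) !)           ≡⟨ nCa*a!*b!≡n! j (k + m) (+-comm j (k + m)) ⟩
    N !                                   ≡⟨ nCa*a!*b!≡n! (m + j) k (m+j+k≡k+m+j k m j) ⟨
    (N C (m + j)) * ((m + j) ! * k !)     ≡⟨ swap (N C (m + j)) ((m + j) !) (k !) ⟩
    k ! * ((N C (m + j)) * (m + j) !)     ∎
    where
    N = k + m + j
    rotate : ∀ x y z → x * y * z ≡ y * (z * x)
    rotate = solve-∀
    swap : ∀ x y z → x * (y * z) ≡ z * (x * y)
    swap = solve-∀
    m+j+k≡k+m+j : ∀ k m j → m + j + k ≡ k + m + j
    m+j+k≡k+m+j = solve-∀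

module _ {c ℓ} (F : CharZeroField c ℓ) where
  open FieldOps F hiding (zero)
  open PowerSeries F
  open import Relation.Binary.Reasoning.Setoid setoid
  open import Algebra.Properties.Ring (CommutativeRing.ring ring) using (-‿involutive; -1*x≈-x; +-cancelˡ)
  open import Algebra.Properties.CommutativeSemigroup *-commutativeSemigroup using (x∙yz≈y∙xz; xy∙z≈y∙xz; interchange)
  open import Algebra.Properties.CommutativeSemigroup +-commutativeSemigroup using () renaming (interchange to +-interchange)
  open NatCoeffSolver commutativeSemiring using (solve; _:+_; _:*_; _:=_)

  fromℕ-+ : ∀ m n → fromℕ (m + n) ≈ fromℕ m +F fromℕ n
  fromℕ-+ zero    n = sym (+-identityˡ _)
  fromℕ-+ (suc m) n = trans (+-congˡ (fromℕ-+ m n)) (sym (+-assoc _ _ _))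

  fromℕ-* : ∀ m n → fromℕ (m Nat.* n) ≈ fromℕ m * fromℕ n
  fromℕ-* zero    n = sym (zeroˡ _)
  fromℕ-* (suc m) n = begin
    fromℕ (n + m Nat.* n)              ≈⟨ fromℕ-+ n (m Nat.* n) ⟩
    fromℕ n +F fromℕ (m Nat.* n)       ≈⟨ +-cong (*-identityˡ _) (sym (fromℕ-* m n)) ⟨
    1# * fromℕ n +F fromℕ m * fromℕ n  ≈⟨ distribʳ _ _ _ ⟨
    (1# +F fromℕ m) * fromℕ n          ∎

  1≉0 : 1# ≉ 0#
  1≉0 1≈0 = char-zero 0 (trans (+-identityʳ 1#) 1≈0)

  fromℕ-nonZero≉0 : ∀ n .{{_ : Nat.NonZero n}} → fromℕ n ≉ 0#
  fromℕ-nonZero≉0 (suc n) = char-zero n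

  fact≉0 : ∀ n → fact n ≉ 0#
  fact≉0 n = fromℕ-nonZero≉0 (n Nat.!) {{ℕₚ._!≢0 n}}

  fact-suc : ∀ n → fact (suc n) ≈ fromℕ (suc n) * fact n
  fact-suc n = fromℕ-* (suc n) (n Nat.!)

  inv-cancelˡ : ∀ {x} y → x ≉ 0# → x * (inv x * y) ≈ y
  inv-cancelˡ {x} y x≉0 = trans (sym (*-assoc _ _ _)) (trans (*-congʳ (inv-law x x≉0)) (*-identityˡ y))

  *-cancelˡ : ∀ {x y z} → x ≉ 0# → x * y ≈ x * z → y ≈ z
  *-cancelˡ {x} {y} {z} x≉0 xy≈xz = begin
    y                ≈⟨ inv-cancelˡ y x≉0 ⟨
    x * (inv x * y)  ≈⟨ x∙yz≈y∙xz x (inv x) y ⟩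
    inv x * (x * y)  ≈⟨ *-congˡ xy≈xz ⟩
    inv x * (x * z)  ≈⟨ x∙yz≈y∙xz (inv x) x z ⟩
    x * (inv x * z)  ≈⟨ inv-cancelˡ z x≉0 ⟩
    z                ∎

  *-≈0⇒≈0 : ∀ {x y} → x ≉ 0# → x * y ≈ 0# → y ≈ 0#
  *-≈0⇒≈0 {x} x≉0 xy≈0 = *-cancelˡ x≉0 (trans xy≈0 (sym (zeroʳ x)))

  cross-multiply : ∀ {x y p q} → p ≉ 0# → q ≉ 0# → x * q ≈ p * y → x * inv p ≈ y * inv q
  cross-multiply {x} {y} {p} {q} p≉0 q≉0 xq≈py = begin
    x * inv p                  ≈⟨ *-identityʳ _ ⟨
    x * inv p * 1#             ≈⟨ *-congˡ (inv-law q q≉0) ⟨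
    x * inv p * (q * inv q)    ≈⟨ solve 4 (λ x p′ q q′ → x :* p′ :* (q :* q′) := x :* q :* p′ :* q′) refl x (inv p) q (inv q) ⟩
    x * q * inv p * inv q      ≈⟨ *-congʳ (*-congʳ xq≈py) ⟩
    p * y * inv p * inv q      ≈⟨ *-congʳ (solve 3 (λ p y p′ → p :* y :* p′ := p :* p′ :* y) refl p y (inv p)) ⟩
    p * inv p * y * inv q      ≈⟨ *-congʳ (trans (*-congʳ (inv-law p p≉0)) (*-identityˡ y)) ⟩
    y * inv q                  ∎

  ^-cong : ∀ {x y} n → x ≈ y → x ^ n ≈ y ^ n
  ^-cong zero    x≈y = refl
  ^-cong (suc n) x≈y = *-cong x≈y (^-cong n x≈y)

  ^-+ : ∀ x m n → x ^ (m + n) ≈ x ^ m * x ^ n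
  ^-+ x zero    n = sym (*-identityˡ _)
  ^-+ x (suc m) n = trans (*-congˡ (^-+ x m n)) (sym (*-assoc _ _ _))

  ^-distrib-* : ∀ x y n → (x * y) ^ n ≈ x ^ n * y ^ n
  ^-distrib-* x y zero    = sym (*-identityˡ _)
  ^-distrib-* x y (suc n) = trans (*-congˡ (^-distrib-* x y n)) (interchange x y (x ^ n) (y ^ n))

  1^n≈1 : ∀ n → 1# ^ n ≈ 1#
  1^n≈1 zero    = refl
  1^n≈1 (suc n) = trans (*-identityˡ _) (1^n≈1 n)

  -1^[p+p]≈1 : ∀ p → (- 1#) ^ (p + p) ≈ 1#
  -1^[p+p]≈1 p = begin
    (- 1#) ^ (p + p)           ≈⟨ ^-+ (- 1#) p p ⟩
    (- 1#) ^ p * (- 1#) ^ p    ≈⟨ ^-distrib-* (- 1#) (- 1#) p ⟨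
    (- 1# * - 1#) ^ p          ≈⟨ ^-cong p -1*-1≈1 ⟩
    1# ^ p                     ≈⟨ 1^n≈1 p ⟩
    1#                         ∎
    where
    -1*-1≈1 : - 1# * - 1# ≈ 1#
    -1*-1≈1 = trans (-1*x≈-x (- 1#)) (-‿involutive 1#)

  Σ≤-cong≤ : ∀ n {f g : ℕ → Carrier} → (∀ i → i ≤ n → f i ≈ g i) → Σ≤ n f ≈ Σ≤ n g
  Σ≤-cong≤ zero    f≈g = f≈g 0 z≤n
  Σ≤-cong≤ (suc n) f≈g = +-cong (Σ≤-cong≤ n (λ i i≤n → f≈g i (ℕₚ.m≤n⇒m≤1+n i≤n))) (f≈g (suc n) ℕₚ.≤-refl)

  Σ≤-cong : ∀ n {f g : ℕ → Carrier} → (∀ i → f i ≈ g i) → Σ≤ n f ≈ Σ≤ n g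
  Σ≤-cong n f≈g = Σ≤-cong≤ n (λ i _ → f≈g i)

  Σ≤-distrib-+ : ∀ n (f g : ℕ → Carrier) → Σ≤ n (λ i → f i +F g i) ≈ Σ≤ n f +F Σ≤ n g
  Σ≤-distrib-+ zero    f g = refl
  Σ≤-distrib-+ (suc n) f g = trans (+-congʳ (Σ≤-distrib-+ n f g)) (+-interchange _ _ _ _)

  *-distribˡ-Σ≤ : ∀ n x (f : ℕ → Carrier) → x * Σ≤ n f ≈ Σ≤ n (λ i → x * f i)
  *-distribˡ-Σ≤ zero    x f = refl
  *-distribˡ-Σ≤ (suc n) x f = trans (distribˡ _ _ _) (+-congʳ (*-distribˡ-Σ≤ n x f))

  *-distribʳ-Σ≤ : ∀ n x (f : ℕ → Carrier) → Σ≤ n f * x ≈ Σ≤ n (λ i → f i * x)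
  *-distribʳ-Σ≤ zero    x f = refl
  *-distribʳ-Σ≤ (suc n) x f = trans (distribʳ _ _ _) (+-congʳ (*-distribʳ-Σ≤ n x f))

  Σ≤-*-Σ≤ : ∀ n m (x y : ℕ → Carrier) → Σ≤ n x * Σ≤ m y ≈ Σ≤ n (λ l → Σ≤ m (λ p → x l * y p))
  Σ≤-*-Σ≤ n m x y = trans (*-distribʳ-Σ≤ n _ x) (Σ≤-cong n (λ l → *-distribˡ-Σ≤ m (x l) y))

  Σ≤-≈0 : ∀ n (f : ℕ → Carrier) → (∀ i → i ≤ n → f i ≈ 0#) → Σ≤ n f ≈ 0#
  Σ≤-≈0 n f f≈0 = trans (Σ≤-cong≤ n f≈0) (Σ≤-const0 n)
    where
    Σ≤-const0 : ∀ n → Σ≤ n (λ _ → 0#) ≈ 0#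
    Σ≤-const0 zero    = refl
    Σ≤-const0 (suc n) = trans (+-identityʳ _) (Σ≤-const0 n)

  Σ≤-first : ∀ n (f : ℕ → Carrier) → Σ≤ (suc n) f ≈ f 0 +F Σ≤ n (λ i → f (suc i))
  Σ≤-first zero    f = refl
  Σ≤-first (suc n) f = trans (+-congʳ (Σ≤-first n f)) (+-assoc _ _ _)

  Σ≤-swap : ∀ n m (A : ℕ → ℕ → Carrier) →
    Σ≤ n (λ i → Σ≤ m (λ j → A i j)) ≈ Σ≤ m (λ j → Σ≤ n (λ i → A i j))
  Σ≤-swap zero    m A = refl
  Σ≤-swap (suc n) m A = trans (+-congʳ (Σ≤-swap n m A))
    (sym (Σ≤-distrib-+ m (λ j → Σ≤ n (λ i → A i j)) (λ j → A (suc n) j)))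

  Σ≤-reverse : ∀ n (f : ℕ → Carrier) → Σ≤ n f ≈ Σ≤ n (λ i → f (n ∸ i))
  Σ≤-reverse zero    f = refl
  Σ≤-reverse (suc n) f = begin
    Σ≤ n f +F f (suc n)                    ≈⟨ +-comm _ _ ⟩
    f (suc n) +F Σ≤ n f                    ≈⟨ +-congˡ (Σ≤-reverse n f) ⟩
    f (suc n) +F Σ≤ n (λ i → f (n ∸ i))    ≈⟨ Σ≤-first n (λ i → f (suc n ∸ i)) ⟨
    Σ≤ (suc n) (λ i → f (suc n ∸ i))       ∎

  Σ≤-triangle : ∀ n (A : ℕ → ℕ → Carrier) →
    Σ≤ n (λ k → Σ≤ k (λ l → A l (k ∸ l))) ≈ Σ≤ n (λ l → Σ≤ (n ∸ l) (λ p → A l p))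
  Σ≤-triangle zero    A = refl
  Σ≤-triangle (suc n) A = begin
    Σ≤ n (λ k → Σ≤ k (λ l → A l (k ∸ l))) +F (Σ≤ n (λ l → A l (suc n ∸ l)) +F A (suc n) (n ∸ n))
      ≈⟨ +-cong (Σ≤-triangle n A) (+-congˡ (reflexive (≡.cong (A (suc n)) (ℕₚ.n∸n≡0 n)))) ⟩
    Σ≤ n (λ l → Σ≤ (n ∸ l) (A l)) +F (Σ≤ n (λ l → A l (suc n ∸ l)) +F A (suc n) 0)
      ≈⟨ +-assoc _ _ _ ⟨
    (Σ≤ n (λ l → Σ≤ (n ∸ l) (A l)) +F Σ≤ n (λ l → A l (suc n ∸ l))) +F A (suc n) 0
      ≈⟨ +-congʳ (Σ≤-distrib-+ n _ _) ⟨
    Σ≤ n (λ l → Σ≤ (n ∸ l) (A l) +F A l (suc n ∸ l)) +F A (suc n) 0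
      ≈⟨ +-congʳ (Σ≤-cong≤ n extend-row) ⟩
    Σ≤ n (λ l → Σ≤ (suc n ∸ l) (A l)) +F Σ≤ 0 (A (suc n))
      ≡⟨ ≡.cong (λ q → Σ≤ n (λ l → Σ≤ (suc n ∸ l) (A l)) +F Σ≤ q (A (suc n))) (ℕₚ.n∸n≡0 n) ⟨
    Σ≤ n (λ l → Σ≤ (suc n ∸ l) (A l)) +F Σ≤ (n ∸ n) (A (suc n)) ∎
    where
    extend-row : ∀ l → l ≤ n → Σ≤ (n ∸ l) (A l) +F A l (suc n ∸ l) ≈ Σ≤ (suc n ∸ l) (A l)
    extend-row l l≤n rewrite ℕₚ.+-∸-assoc 1 l≤n = refl

  Σ≤-single : ∀ n j (f : ℕ → Carrier) → j ≤ n → (∀ i → i ≤ n → i ≢ j → f i ≈ 0#) → Σ≤ n f ≈ f j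
  Σ≤-single zero    .zero f z≤n  f≈0 = refl
  Σ≤-single (suc n) j    f j≤1+n f≈0 with ℕₚ.m≤n⇒m<n∨m≡n j≤1+n
  ... | inj₁ (s≤s j≤n) = trans (+-cong (Σ≤-single n j f j≤n (λ i i≤n → f≈0 i (ℕₚ.m≤n⇒m≤1+n i≤n)))
                                       (f≈0 (suc n) ℕₚ.≤-refl (λ 1+n≡j → ℕₚ.<⇒≢ (s≤s j≤n) (≡.sym 1+n≡j))))
                               (+-identityʳ _)
  ... | inj₂ ≡.refl = trans (+-congʳ (Σ≤-≈0 n f (λ i i≤n → f≈0 i (ℕₚ.m≤n⇒m≤1+n i≤n) (ℕₚ.<⇒≢ (s≤s i≤n)))))
                            (+-identityˡ _)

  Σ≤-truncate : ∀ {m n} (f : ℕ → Carrier) → m ≤ n → (∀ i → m < i → i ≤ n → f i ≈ 0#) → Σ≤ n f ≈ Σ≤ m f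
  Σ≤-truncate {m} {n} f m≤n f≈0 = begin
    Σ≤ n f               ≡⟨ ≡.cong (λ q → Σ≤ q f) (ℕₚ.m∸n+n≡m m≤n) ⟨
    Σ≤ (n ∸ m + m) f     ≈⟨ drop (n ∸ m) (λ i m<i i≤ → f≈0 i m<i (≡.subst (i ≤_) (ℕₚ.m∸n+n≡m m≤n) i≤)) ⟩
    Σ≤ m f               ∎
    where
    drop : ∀ d → (∀ i → m < i → i ≤ d + m → f i ≈ 0#) → Σ≤ (d + m) f ≈ Σ≤ m f
    drop zero    _   = refl
    drop (suc d) f≈0′ = trans (+-cong (drop d (λ i m<i i≤ → f≈0′ i m<i (ℕₚ.m≤n⇒m≤1+n i≤)))
                                      (f≈0′ (suc (d + m)) (s≤s (ℕₚ.m≤n+m m d)) ℕₚ.≤-refl))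
                              (+-identityʳ _)

  -- Formal power series

  infixl 6 _⊕_
  _⊕_ : PS → PS → PS
  (a ⊕ b) n = a n +F b n

  const : Carrier → PS
  const x zero    = x
  const x (suc _) = 0#

  0ₛ 1ₛ : PS
  0ₛ _ = 0#
  1ₛ = const 1#

  ≋-refl : ∀ {a} → a ≋ a
  ≋-refl n = refl

  ≋-sym : ∀ {a b} → a ≋ b → b ≋ a
  ≋-sym a≋b n = sym (a≋b n)

  ≋-trans : ∀ {a b d} → a ≋ b → b ≋ d → a ≋ d
  ≋-trans a≋b b≋d n = trans (a≋b n) (b≋d n)

  infix  1 ≋-begin_
  infixr 2 _≋⟨_⟩_
  infix  3 _≋-∎
  ≋-begin_ : ∀ {a b} → a ≋ b → a ≋ b
  ≋-begin a≋b = a≋b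
  _≋⟨_⟩_ : ∀ a {b d} → a ≋ b → b ≋ d → a ≋ d
  a ≋⟨ a≋b ⟩ b≋d = ≋-trans a≋b b≋d
  _≋-∎ : ∀ a → a ≋ a
  a ≋-∎ = ≋-refl

  pow-zero : ∀ a → pow a 0 ≋ 1ₛ
  pow-zero a zero    = refl
  pow-zero a (suc n) = refl

  ·-cong : ∀ {a a′ b b′} → a ≋ a′ → b ≋ b′ → (a · b) ≋ (a′ · b′)
  ·-cong a≋a′ b≋b′ n = Σ≤-cong n (λ i → *-cong (a≋a′ i) (b≋b′ (n ∸ i)))

  ·-congˡ : ∀ a {b b′} → b ≋ b′ → (a · b) ≋ (a · b′)
  ·-congˡ a = ·-cong (≋-refl {a})

  ·-congʳ : ∀ b {a a′} → a ≋ a′ → (a · b) ≋ (a′ · b)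
  ·-congʳ b a≋a′ = ·-cong a≋a′ (≋-refl {b})

  ·-comm : ∀ a b → (a · b) ≋ (b · a)
  ·-comm a b n = begin
    Σ≤ n (λ i → a i * b (n ∸ i))                ≈⟨ Σ≤-reverse n _ ⟩
    Σ≤ n (λ i → a (n ∸ i) * b (n ∸ (n ∸ i)))    ≈⟨ Σ≤-cong≤ n (λ i i≤n →
                                                     trans (*-comm _ _) (*-congʳ (reflexive (≡.cong b (ℕₚ.m∸[m∸n]≡n i≤n))))) ⟩
    Σ≤ n (λ i → b i * a (n ∸ i))                ∎

  ·-assoc : ∀ a b d → ((a · b) · d) ≋ (a · (b · d))
  ·-assoc a b d n = begin
    Σ≤ n (λ k → Σ≤ k (λ l → a l * b (k ∸ l)) * d (n ∸ k))
      ≈⟨ Σ≤-cong≤ n (λ k k≤n → trans (*-distribʳ-Σ≤ k _ _) (Σ≤-cong≤ k (λ l l≤k →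
           trans (*-assoc _ _ _) (*-congˡ (*-congˡ (reflexive (≡.cong d (n∸k≡n∸l∸[k∸l] k l l≤k)))))))) ⟩
    Σ≤ n (λ k → Σ≤ k (λ l → a l * (b (k ∸ l) * d (n ∸ l ∸ (k ∸ l)))))
      ≈⟨ Σ≤-triangle n (λ l p → a l * (b p * d (n ∸ l ∸ p))) ⟩
    Σ≤ n (λ l → Σ≤ (n ∸ l) (λ p → a l * (b p * d (n ∸ l ∸ p))))
      ≈⟨ Σ≤-cong n (λ l → sym (*-distribˡ-Σ≤ (n ∸ l) _ _)) ⟩
    Σ≤ n (λ l → a l * Σ≤ (n ∸ l) (λ p → b p * d (n ∸ l ∸ p))) ∎
    where
    n∸k≡n∸l∸[k∸l] : ∀ k l → l ≤ k → n ∸ k ≡ n ∸ l ∸ (k ∸ l)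
    n∸k≡n∸l∸[k∸l] k l l≤k = ≡.trans (≡.cong (n ∸_) (≡.sym (ℕₚ.m+[n∸m]≡n l≤k))) (≡.sym (ℕₚ.∸-+-assoc n l (k ∸ l)))

  ·-distribʳ : ∀ a b d → ((b ⊕ d) · a) ≋ ((b · a) ⊕ (d · a))
  ·-distribʳ a b d n = trans (Σ≤-cong n (λ i → distribʳ _ _ _)) (Σ≤-distrib-+ n _ _)

  const-· : ∀ x a → (const x · a) ≋ (λ n → x * a n)
  const-· x a n = Σ≤-single n 0 _ z≤n (λ { zero _ 0≢0 → ⊥-elim (0≢0 ≡.refl) ; (suc i) _ _ → zeroˡ _ })

  1ₛ-· : ∀ a → (1ₛ · a) ≋ a
  1ₛ-· a n = trans (const-· 1# a n) (*-identityˡ _)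

  0ₛ-· : ∀ a → (0ₛ · a) ≋ 0ₛ
  0ₛ-· a n = Σ≤-≈0 n _ (λ i _ → zeroˡ _)

  ≋-isEquivalence : IsEquivalence _≋_
  ≋-isEquivalence = record { refl = ≋-refl ; sym = ≋-sym ; trans = ≋-trans }

  ⊕-isCommutativeMonoid : IsCommutativeMonoid _≋_ _⊕_ 0ₛ
  ⊕-isCommutativeMonoid = record
    { isMonoid = record
      { isSemigroup = record
        { isMagma = record { isEquivalence = ≋-isEquivalence ; ∙-cong = λ e f n → +-cong (e n) (f n) }
        ; assoc = λ a b d n → +-assoc _ _ _ }
      ; identity = (λ a n → +-identityˡ _) , (λ a n → +-identityʳ _) }
    ; comm = λ a b n → +-comm _ _ }

  ·-isCommutativeMonoid : IsCommutativeMonoid _≋_ _·_ 1ₛ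
  ·-isCommutativeMonoid = record
    { isMonoid = record
      { isSemigroup = record
        { isMagma = record { isEquivalence = ≋-isEquivalence ; ∙-cong = ·-cong }
        ; assoc = ·-assoc }
      ; identity = 1ₛ-· , (λ a → ≋-trans (·-comm a 1ₛ) (1ₛ-· a)) }
    ; comm = ·-comm }

  seriesSemiring : CommutativeSemiring c ℓ
  seriesSemiring = record
    { Carrier = PS ; _≈_ = _≋_ ; _+_ = _⊕_ ; _*_ = _·_ ; 0# = 0ₛ ; 1# = 1ₛ
    ; isCommutativeSemiring = Biased.IsCommutativeSemiringˡ.isCommutativeSemiring (record
      { +-isCommutativeMonoid = ⊕-isCommutativeMonoid ; *-isCommutativeMonoid = ·-isCommutativeMonoid
      ; distribʳ = ·-distribʳ ; zeroˡ = 0ₛ-· })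
    }

  module S = CommutativeSemiring seriesSemiring
  open NatCoeffSolver seriesSemiring using ()
    renaming (solve to solveₛ; _:+_ to _⊞_; _:*_ to _⊠_; _:=_ to _≐_; con to conₛ)
  open import Algebra.Properties.Semiring.Exp S.semiring using () renaming (_^_ to _^ₛ_; ^-homo-* to ^ₛ-homo-*; ^-congˡ to ^ₛ-congˡ)
  open import Algebra.Properties.CommutativeSemiring.Exp seriesSemiring using () renaming (^-distrib-* to ^ₛ-distrib-*)

  pow≋^ₛ : ∀ a n → pow a n ≋ (a ^ₛ n)
  pow≋^ₛ a zero    = pow-zero a
  pow≋^ₛ a (suc n) = ·-congˡ a (pow≋^ₛ a n)

  pow-cong : ∀ {a b} n → a ≋ b → pow a n ≋ pow b n
  pow-cong {a} {b} n a≋b = ≋-trans (pow≋^ₛ a n) (≋-trans (^ₛ-congˡ n a≋b) (≋-sym (pow≋^ₛ b n)))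

  pow-+ : ∀ a m n → pow a (m + n) ≋ (pow a m · pow a n)
  pow-+ a m n = ≋-trans (pow≋^ₛ a (m + n)) (≋-trans (^ₛ-homo-* a m n) (·-cong (≋-sym (pow≋^ₛ a m)) (≋-sym (pow≋^ₛ a n))))

  pow-distrib-· : ∀ a b n → pow (a · b) n ≋ (pow a n · pow b n)
  pow-distrib-· a b n = ≋-trans (pow≋^ₛ _ n) (≋-trans (^ₛ-distrib-* a b n) (·-cong (≋-sym (pow≋^ₛ a n)) (≋-sym (pow≋^ₛ b n))))

  pow-one : ∀ a → pow a 1 ≋ a
  pow-one a = ≋-trans (·-congˡ a (pow-zero a)) (S.*-identityʳ a)

  const-cong : ∀ {x y} → x ≈ y → const x ≋ const y
  const-cong x≈y zero    = x≈y
  const-cong x≈y (suc n) = refl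

  const-+ : ∀ x y → const (x +F y) ≋ (const x ⊕ const y)
  const-+ x y zero    = refl
  const-+ x y (suc n) = sym (+-identityʳ 0#)

  const-* : ∀ x y → const (x * y) ≋ (const x · const y)
  const-* x y = ≋-sym (≋-trans (const-· x (const y)) λ { zero → refl ; (suc n) → zeroʳ _ })

  const-pow : ∀ x n → pow (const x) n ≋ const (x ^ n)
  const-pow x zero    = pow-zero (const x)
  const-pow x (suc n) = ≋-trans (·-congˡ (const x) (const-pow x n)) (≋-sym (const-* x (x ^ n)))

  ·const : ∀ a x m → (a · const x) m ≈ x * a m
  ·const a x m = trans (·-comm a (const x) m) (const-· x a m)

  ·[const·]-coeff : ∀ x a b n → (a · (const x · b)) n ≈ x * (a · b) n
  ·[const·]-coeff x a b n = begin
    (a · (const x · b)) n                 ≈⟨ ·-congˡ a (const-· x b) n ⟩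
    Σ≤ n (λ i → a i * (x * b (n ∸ i)))     ≈⟨ Σ≤-cong n (λ i → x∙yz≈y∙xz (a i) x (b (n ∸ i))) ⟩
    Σ≤ n (λ i → x * (a i * b (n ∸ i)))     ≈⟨ *-distribˡ-Σ≤ n x _ ⟨
    x * (a · b) n                         ∎

  X·-shift : ∀ a n → (X · a) (suc n) ≈ a n
  X·-shift a n = trans (Σ≤-single (suc n) 1 _ (s≤s z≤n) λ
      { zero _ _ → zeroˡ _ ; (suc zero) _ 1≢1 → ⊥-elim (1≢1 ≡.refl) ; (suc (suc i)) _ _ → zeroˡ _ })
    (*-identityˡ _)

  Xʲ·-shift : ∀ j a m → (pow X j · a) (j + m) ≈ a m
  Xʲ·-shift zero    a m = trans (·-congʳ a (pow-zero X) m) (1ₛ-· a m)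
  Xʲ·-shift (suc j) a m = trans (·-assoc X (pow X j) a (suc (j + m))) (trans (X·-shift (pow X j · a) (j + m)) (Xʲ·-shift j a m))

  pow-coeff-below : ∀ u → u 0 ≈ 0# → ∀ k n → n < k → pow u k n ≈ 0#
  pow-coeff-below u u₀≈0 (suc k) n n<1+k = Σ≤-≈0 n _ λ
    { zero _ → trans (*-congʳ u₀≈0) (zeroˡ _)
    ; (suc i) 1+i≤n → trans (*-congˡ (pow-coeff-below u u₀≈0 k (n ∸ suc i) (n∸[1+i]<k n i n<1+k 1+i≤n))) (zeroʳ _) }
    where
    n∸[1+i]<k : ∀ n i → n < suc k → suc i ≤ n → n ∸ suc i < k
    n∸[1+i]<k (suc n) i (s≤s n<k) (s≤s _) = ℕₚ.≤-<-trans (ℕₚ.m∸n≤m n i) n<k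

  -- Composition

  ∘ₛ-congˡ : ∀ {a a′} u → a ≋ a′ → (a ∘ₛ u) ≋ (a′ ∘ₛ u)
  ∘ₛ-congˡ u a≋a′ n = Σ≤-cong n (λ k → *-congʳ (a≋a′ k))

  ∘ₛ-truncate : ∀ a u → u 0 ≈ 0# → ∀ M n → n ≤ M → Σ≤ M (λ k → a k * pow u k n) ≈ (a ∘ₛ u) n
  ∘ₛ-truncate a u u₀≈0 M n n≤M =
    Σ≤-truncate _ n≤M (λ k n<k _ → trans (*-congˡ (pow-coeff-below u u₀≈0 k n n<k)) (zeroʳ _))

  1ₛ-∘ₛ : ∀ u → (1ₛ ∘ₛ u) ≋ 1ₛ
  1ₛ-∘ₛ u n = trans (Σ≤-single n 0 _ z≤n (λ { zero _ 0≢0 → ⊥-elim (0≢0 ≡.refl) ; (suc i) _ _ → zeroˡ _ }))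
                    (trans (*-identityˡ _) (pow-zero u n))

  ⊕-∘ₛ : ∀ a b u → ((a ⊕ b) ∘ₛ u) ≋ ((a ∘ₛ u) ⊕ (b ∘ₛ u))
  ⊕-∘ₛ a b u n = trans (Σ≤-cong n (λ k → distribʳ _ _ _)) (Σ≤-distrib-+ n _ _)

  X-∘ₛ : ∀ u → u 0 ≈ 0# → (X ∘ₛ u) ≋ u
  X-∘ₛ u u₀≈0 zero    = trans (zeroˡ _) (sym u₀≈0)
  X-∘ₛ u u₀≈0 (suc n) = trans (Σ≤-single (suc n) 1 _ (s≤s z≤n)
      (λ { zero _ _ → zeroˡ _ ; (suc zero) _ 1≢1 → ⊥-elim (1≢1 ≡.refl) ; (suc (suc i)) _ _ → zeroˡ _ }))
    (trans (*-identityˡ _) (pow-one u (suc n)))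

  ·-∘ₛ : ∀ a b u → u 0 ≈ 0# → ((a · b) ∘ₛ u) ≋ ((a ∘ₛ u) · (b ∘ₛ u))
  ·-∘ₛ a b u u₀≈0 n = begin
    Σ≤ n (λ k → Σ≤ k (λ l → a l * b (k ∸ l)) * pow u k n)
      ≈⟨ Σ≤-cong≤ n (λ k k≤n → trans (*-distribʳ-Σ≤ k _ _) (Σ≤-cong≤ k (λ l l≤k → *-congˡ (split-power l k l≤k)))) ⟩
    Σ≤ n (λ k → Σ≤ k (λ l → A l (k ∸ l)))                          ≈⟨ Σ≤-triangle n A ⟩
    Σ≤ n (λ l → Σ≤ (n ∸ l) (A l))                                  ≈⟨ Σ≤-cong≤ n extend-row ⟨
    Σ≤ n (λ l → Σ≤ n (A l))                                        ≈⟨ Σ≤-cong n (λ l → Σ≤-cong n (expand l)) ⟩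
    Σ≤ n (λ l → Σ≤ n (λ p → Σ≤ n (B l p)))                         ≈⟨ Σ≤-cong n (λ l → Σ≤-swap n n _) ⟩
    Σ≤ n (λ l → Σ≤ n (λ i → Σ≤ n (λ p → B l p i)))                 ≈⟨ Σ≤-swap n n _ ⟩
    Σ≤ n (λ i → Σ≤ n (λ l → Σ≤ n (λ p → B l p i)))                 ≈⟨ Σ≤-cong n (λ i → Σ≤-*-Σ≤ n n _ _) ⟨
    Σ≤ n (λ i → Σ≤ n (λ l → a l * pow u l i) * Σ≤ n (λ p → b p * pow u p (n ∸ i)))
      ≈⟨ Σ≤-cong≤ n (λ i i≤n → *-cong (∘ₛ-truncate a u u₀≈0 n i i≤n) (∘ₛ-truncate b u u₀≈0 n (n ∸ i) (ℕₚ.m∸n≤m n i))) ⟩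
    Σ≤ n (λ i → (a ∘ₛ u) i * (b ∘ₛ u) (n ∸ i))                     ∎
    where
    A : ℕ → ℕ → Carrier
    A l p = (a l * b p) * pow u (l + p) n
    B : ℕ → ℕ → ℕ → Carrier
    B l p i = (a l * pow u l i) * (b p * pow u p (n ∸ i))
    split-power : ∀ l k → l ≤ k → pow u k n ≈ pow u (l + (k ∸ l)) n
    split-power l k l≤k = reflexive (≡.cong (λ q → pow u q n) (≡.sym (ℕₚ.m+[n∸m]≡n l≤k)))
    extend-row : ∀ l → l ≤ n → Σ≤ n (A l) ≈ Σ≤ (n ∸ l) (A l)
    extend-row l l≤n = Σ≤-truncate _ (ℕₚ.m∸n≤m n l) (λ p n∸l<p _ →
      trans (*-congˡ (pow-coeff-below u u₀≈0 (l + p) n (n<l+p n∸l<p))) (zeroʳ _))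
      where
      n<l+p : ∀ {p} → n ∸ l < p → n < l + p
      n<l+p n∸l<p = ≡.subst (_< l + _) (ℕₚ.m+[n∸m]≡n l≤n) (ℕₚ.+-monoʳ-< l n∸l<p)
    expand : ∀ l p → A l p ≈ Σ≤ n (B l p)
    expand l p = trans (*-congˡ (pow-+ u l p n)) (trans (*-distribˡ-Σ≤ n _ _)
      (Σ≤-cong n (λ i → interchange (a l) (b p) (pow u l i) (pow u p (n ∸ i)))))

  pow-∘ₛ : ∀ a u → u 0 ≈ 0# → ∀ n → (pow a n ∘ₛ u) ≋ pow (a ∘ₛ u) n
  pow-∘ₛ a u u₀≈0 zero    = ≋-trans (∘ₛ-congˡ u (pow-zero a)) (≋-trans (1ₛ-∘ₛ u) (≋-sym (pow-zero (a ∘ₛ u))))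
  pow-∘ₛ a u u₀≈0 (suc n) = ≋-trans (·-∘ₛ a (pow a n) u u₀≈0) (·-congˡ (a ∘ₛ u) (pow-∘ₛ a u u₀≈0 n))

  -- The Euler operator θ = t d/dt

  θ : PS → PS
  θ a n = fromℕ n * a n

  θ-cong : ∀ {a b} → a ≋ b → θ a ≋ θ b
  θ-cong a≋b n = *-congˡ (a≋b n)

  θ-Leibniz : ∀ a b → θ (a · b) ≋ ((θ a · b) ⊕ (a · θ b))
  θ-Leibniz a b n = begin
    fromℕ n * Σ≤ n (λ i → a i * b (n ∸ i))               ≈⟨ *-distribˡ-Σ≤ n _ _ ⟩
    Σ≤ n (λ i → fromℕ n * (a i * b (n ∸ i)))             ≈⟨ Σ≤-cong≤ n split-weight ⟩
    Σ≤ n (λ i → (fromℕ i * a i) * b (n ∸ i) +F a i * (fromℕ (n ∸ i) * b (n ∸ i)))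
                                                          ≈⟨ Σ≤-distrib-+ n _ _ ⟩
    ((θ a · b) ⊕ (a · θ b)) n                             ∎
    where
    split-weight : ∀ i → i ≤ n →
      fromℕ n * (a i * b (n ∸ i)) ≈ (fromℕ i * a i) * b (n ∸ i) +F a i * (fromℕ (n ∸ i) * b (n ∸ i))
    split-weight i i≤n = begin
      fromℕ n * (a i * b (n ∸ i))                  ≡⟨ ≡.cong (λ q → fromℕ q * (a i * b (n ∸ i))) (ℕₚ.m+[n∸m]≡n i≤n) ⟨
      fromℕ (i + (n ∸ i)) * (a i * b (n ∸ i))      ≈⟨ *-congʳ (fromℕ-+ i (n ∸ i)) ⟩
      (fromℕ i +F fromℕ (n ∸ i)) * (a i * b (n ∸ i))
        ≈⟨ solve 4 (λ x y p q → (x :+ y) :* (p :* q) := (x :* p) :* q :+ p :* (y :* q)) refl _ _ _ _ ⟩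
      (fromℕ i * a i) * b (n ∸ i) +F a i * (fromℕ (n ∸ i) * b (n ∸ i)) ∎

  θ-1ₛ : θ 1ₛ ≋ 0ₛ
  θ-1ₛ zero    = zeroˡ _
  θ-1ₛ (suc n) = zeroʳ _

  θ-X : θ X ≋ X
  θ-X zero          = zeroʳ _
  θ-X (suc zero)    = trans (*-identityʳ _) (+-identityʳ _)
  θ-X (suc (suc n)) = zeroʳ _

  θ-pow-zero : ∀ a → θ (pow a 0) ≋ 0ₛ
  θ-pow-zero a = ≋-trans (θ-cong (pow-zero a)) θ-1ₛ

  θ-pow : ∀ a k → θ (pow a (suc k)) ≋ (const (fromℕ (suc k)) · (pow a k · θ a))
  θ-pow a zero = ≋-begin
    θ (a · pow a 0)                     ≋⟨ θ-Leibniz a (pow a 0) ⟩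
    (θ a · pow a 0) ⊕ (a · θ (pow a 0)) ≋⟨ S.+-cong (·-congˡ (θ a) (pow-zero a)) (·-congˡ a (θ-pow-zero a)) ⟩
    (θ a · 1ₛ) ⊕ (a · 0ₛ)               ≋⟨ solveₛ 2 (λ t x → t ⊠ conₛ 1 ⊞ x ⊠ conₛ 0 ≐ conₛ 1 ⊠ (conₛ 1 ⊠ t)) ≋-refl (θ a) a ⟩
    1ₛ · (1ₛ · θ a)                     ≋⟨ ·-cong (const-cong (sym (+-identityʳ 1#))) (·-congʳ (θ a) (≋-sym (pow-zero a))) ⟩
    const (fromℕ 1) · (pow a 0 · θ a)   ≋-∎
  θ-pow a (suc k) = ≋-begin
    θ (a · pow a (suc k))                               ≋⟨ θ-Leibniz a (pow a (suc k)) ⟩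
    (θ a · pow a (suc k)) ⊕ (a · θ (pow a (suc k)))     ≋⟨ S.+-congˡ (·-congˡ a (θ-pow a k)) ⟩
    (θ a · (a · pow a k)) ⊕ (a · (w · (pow a k · θ a))) ≋⟨ solveₛ 4 (λ t x p c → t ⊠ (x ⊠ p) ⊞ x ⊠ (c ⊠ (p ⊠ t)) ≐ (conₛ 1 ⊞ c) ⊠ ((x ⊠ p) ⊠ t))
                                                             ≋-refl (θ a) a (pow a k) w ⟩
    (1ₛ ⊕ w) · (pow a (suc k) · θ a)                    ≋⟨ ·-congʳ (pow a (suc k) · θ a) (≋-sym (const-+ 1# (fromℕ (suc k)))) ⟩
    const (fromℕ (suc (suc k))) · (pow a (suc k) · θ a) ≋-∎
    where
    w : PS
    w = const (fromℕ (suc k))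

  θ-Xᵏ : ∀ k → θ (pow X k) ≋ (const (fromℕ k) · pow X k)
  θ-Xᵏ zero    = ≋-trans (θ-pow-zero X) (≋-sym (≋-trans (const-· 0# (pow X 0)) (λ n → zeroˡ _)))
  θ-Xᵏ (suc k) = ≋-trans (θ-pow X k) (·-congˡ (const (fromℕ (suc k))) (≋-trans (·-congˡ (pow X k) θ-X) (·-comm (pow X k) X)))

  [a·θXᵏ]ₖ₊ₘ≈k*aₘ : ∀ a k m → (a · θ (pow X k)) (k + m) ≈ fromℕ k * a m
  [a·θXᵏ]ₖ₊ₘ≈k*aₘ a k m = begin
    (a · θ (pow X k)) (k + m)                   ≈⟨ ·-congˡ a (θ-Xᵏ k) (k + m) ⟩
    (a · (const (fromℕ k) · pow X k)) (k + m)   ≈⟨ ·[const·]-coeff (fromℕ k) a (pow X k) (k + m) ⟩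
    fromℕ k * (a · pow X k) (k + m)             ≈⟨ *-congˡ (·-comm a (pow X k) (k + m)) ⟩
    fromℕ k * (pow X k · a) (k + m)             ≈⟨ *-congˡ (Xʲ·-shift k a m) ⟩
    fromℕ k * a m                               ∎

  module LagrangeInversion (h ψ g : PS) (h₀≈0 : h 0 ≈ 0#) (ψ·h≋X : (ψ · h) ≋ X) (g∘h≋X : (g ∘ₛ h) ≋ X) where
    open import Algebra.Properties.CommutativeSemigroup S.*-commutativeSemigroup using () renaming (interchange to ·-interchange)

    [ψʲ⁺ʳhʲθh]ⱼ₊ᵣ≈[ψʳθh]ᵣ : ∀ j r → (pow ψ (j + r) · (pow h j · θ h)) (j + r) ≈ (pow ψ r · θ h) r
    [ψʲ⁺ʳhʲθh]ⱼ₊ᵣ≈[ψʳθh]ᵣ j r = trans (ψʲ⁺ʳhʲθh≋Xʲψʳθh (j + r)) (Xʲ·-shift j (pow ψ r · θ h) r)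
      where
      ψʲ⁺ʳhʲθh≋Xʲψʳθh : (pow ψ (j + r) · (pow h j · θ h)) ≋ (pow X j · (pow ψ r · θ h))
      ψʲ⁺ʳhʲθh≋Xʲψʳθh = ≋-begin
        pow ψ (j + r) · (pow h j · θ h)        ≋⟨ ·-congʳ (pow h j · θ h) (pow-+ ψ j r) ⟩
        (pow ψ j · pow ψ r) · (pow h j · θ h)  ≋⟨ ·-interchange (pow ψ j) (pow ψ r) (pow h j) (θ h) ⟩
        (pow ψ j · pow h j) · (pow ψ r · θ h)  ≋⟨ ·-congʳ (pow ψ r · θ h) (≋-trans (≋-sym (pow-distrib-· ψ h j)) (pow-cong j ψ·h≋X)) ⟩
        pow X j · (pow ψ r · θ h)              ≋-∎

    [ψθh]₁≈1 : (pow ψ 1 · θ h) 1 ≈ 1#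
    [ψθh]₁≈1 = begin
      (pow ψ 1 · θ h) 1                        ≈⟨ ·-congʳ (θ h) (pow-one ψ) 1 ⟩
      ψ 0 * (fromℕ 1 * h 1) +F ψ 1 * (0# * h 0) ≈⟨ +-cong (*-congˡ (trans (*-congʳ (+-identityʳ 1#)) (*-identityˡ _)))
                                                          (*-congˡ (trans (zeroˡ _) (sym h₀≈0))) ⟩
      ψ 0 * h 1 +F ψ 1 * h 0                   ≈⟨ ψ·h≋X 1 ⟩
      1#                                       ∎

    -- θ(ψh) = θt = t gives θψ·h + ψ·θh = t.  Multiplying by ψʳ⁺¹ and comparing with
    -- θ(ψʳ⁺¹) = (r+1)ψʳθψ leaves (r+1)·[t^{r+2}](ψʳ⁺²θh) = 0.
    [ψ²⁺ʳθh]₂₊ᵣ≈0 : ∀ r → (pow ψ (2 + r) · θ h) (2 + r) ≈ 0#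
    [ψ²⁺ʳθh]₂₊ᵣ≈0 r = *-≈0⇒≈0 (char-zero r) [r+1]W≈0
      where
      P W : PS
      P = pow ψ r
      W = pow ψ (2 + r) · θ h
      θψ·h⊕ψ·θh≋X : ((θ ψ · h) ⊕ (ψ · θ h)) ≋ X
      θψ·h⊕ψ·θh≋X = ≋-trans (≋-sym (θ-Leibniz ψ h)) (≋-trans (θ-cong ψ·h≋X) θ-X)
      multiplied : (((P · θ ψ) · X) ⊕ W) ≋ ((ψ · P) · X)
      multiplied = ≋-begin
        ((P · θ ψ) · X) ⊕ W                          ≋⟨ S.+-congʳ (·-congˡ (P · θ ψ) (≋-sym ψ·h≋X)) ⟩
        ((P · θ ψ) · (ψ · h)) ⊕ ((ψ · (ψ · P)) · θ h) ≋⟨ solveₛ 5 (λ y p t x s → (p ⊠ t) ⊠ (y ⊠ x) ⊞ (y ⊠ (y ⊠ p)) ⊠ s ≐ (y ⊠ p) ⊠ ((t ⊠ x) ⊞ (y ⊠ s)))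
                                                            ≋-refl ψ P (θ ψ) h (θ h) ⟩
        (ψ · P) · ((θ ψ · h) ⊕ (ψ · θ h))             ≋⟨ ·-congˡ (ψ · P) θψ·h⊕ψ·θh≋X ⟩
        (ψ · P) · X                                  ≋-∎
      ·X-shift : ∀ a n → (a · X) (suc n) ≈ a n
      ·X-shift a n = trans (·-comm a X (suc n)) (X·-shift a n)
      coeff : (P · θ ψ) (suc r) +F W (2 + r) ≈ (ψ · P) (suc r)
      coeff = trans (+-congʳ (sym (·X-shift (P · θ ψ) (suc r)))) (trans (multiplied (2 + r)) (·X-shift (ψ · P) (suc r)))
      θψʳ⁺¹ : fromℕ (suc r) * (ψ · P) (suc r) ≈ fromℕ (suc r) * (P · θ ψ) (suc r)
      θψʳ⁺¹ = trans (θ-pow ψ r (suc r)) (const-· (fromℕ (suc r)) (P · θ ψ) (suc r))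
      [r+1]W≈0 : fromℕ (suc r) * W (2 + r) ≈ 0#
      [r+1]W≈0 = +-cancelˡ (fromℕ (suc r) * (P · θ ψ) (suc r)) _ _ (begin
        fromℕ (suc r) * (P · θ ψ) (suc r) +F fromℕ (suc r) * W (2 + r) ≈⟨ distribˡ _ _ _ ⟨
        fromℕ (suc r) * ((P · θ ψ) (suc r) +F W (2 + r))              ≈⟨ *-congˡ coeff ⟩
        fromℕ (suc r) * (ψ · P) (suc r)                               ≈⟨ θψʳ⁺¹ ⟩
        fromℕ (suc r) * (P · θ ψ) (suc r)                             ≈⟨ +-identityʳ _ ⟨
        fromℕ (suc r) * (P · θ ψ) (suc r) +F 0#                       ∎)

    [ψʲ⁺ʳθhʲ⁺¹]ⱼ₊ᵣ : ∀ j r → (pow ψ (j + r) · θ (pow h (suc j))) (j + r) ≈ fromℕ (suc j) * (pow ψ r · θ h) r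
    [ψʲ⁺ʳθhʲ⁺¹]ⱼ₊ᵣ j r = begin
      (pow ψ (j + r) · θ (pow h (suc j))) (j + r)                        ≈⟨ ·-congˡ (pow ψ (j + r)) (θ-pow h j) (j + r) ⟩
      (pow ψ (j + r) · (const (fromℕ (suc j)) · (pow h j · θ h))) (j + r) ≈⟨ ·[const·]-coeff (fromℕ (suc j)) (pow ψ (j + r)) (pow h j · θ h) (j + r) ⟩
      fromℕ (suc j) * (pow ψ (j + r) · (pow h j · θ h)) (j + r)          ≈⟨ *-congˡ ([ψʲ⁺ʳhʲθh]ⱼ₊ᵣ≈[ψʳθh]ᵣ j r) ⟩
      fromℕ (suc j) * (pow ψ r · θ h) r                                  ∎

    [ψⁿθh⁰]ₙ≈0 : ∀ n → (pow ψ n · θ (pow h 0)) n ≈ 0#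
    [ψⁿθh⁰]ₙ≈0 n = trans (·-congˡ (pow ψ n) (θ-pow-zero h) n) (S.zeroʳ (pow ψ n) n)

    [ψⁿθhⁿ]ₙ≈n : ∀ n → (pow ψ n · θ (pow h n)) n ≈ fromℕ n
    [ψⁿθhⁿ]ₙ≈n zero    = [ψⁿθh⁰]ₙ≈0 0
    [ψⁿθhⁿ]ₙ≈n (suc j) = begin
      (pow ψ (suc j) · θ (pow h (suc j))) (suc j)  ≡⟨ ≡.cong (λ n → (pow ψ n · θ (pow h (suc j))) n) (ℕₚ.+-comm 1 j) ⟩
      (pow ψ (j + 1) · θ (pow h (suc j))) (j + 1)  ≈⟨ [ψʲ⁺ʳθhʲ⁺¹]ⱼ₊ᵣ j 1 ⟩
      fromℕ (suc j) * (pow ψ 1 · θ h) 1            ≈⟨ *-congˡ [ψθh]₁≈1 ⟩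
      fromℕ (suc j) * 1#                           ≈⟨ *-identityʳ _ ⟩
      fromℕ (suc j)                                ∎

    [ψⁿθhʲ]ₙ≈0 : ∀ j n → j < n → (pow ψ n · θ (pow h j)) n ≈ 0#
    [ψⁿθhʲ]ₙ≈0 zero    n _     = [ψⁿθh⁰]ₙ≈0 n
    [ψⁿθhʲ]ₙ≈0 (suc j) n 1+j<n with n≡j+[2+d] j n 1+j<n
      where
      n≡j+[2+d] : ∀ j n → suc j < n → Σ ℕ (λ d → n ≡ j + (2 + d))
      n≡j+[2+d] zero    (suc (suc d)) _           = d , ≡.refl
      n≡j+[2+d] zero    (suc zero)    (s≤s ())
      n≡j+[2+d] (suc j) (suc n)       (s≤s 1+j<n) with n≡j+[2+d] j n 1+j<n
      ... | d , n≡ = d , ≡.cong suc n≡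
    ... | d , ≡.refl = trans ([ψʲ⁺ʳθhʲ⁺¹]ⱼ₊ᵣ j (2 + d)) (trans (*-congˡ ([ψ²⁺ʳθh]₂₊ᵣ≈0 d)) (zeroʳ _))

    θXᵏ-via-h : ∀ a k n → (a · θ (pow X k)) n ≈ Σ≤ n (λ j → pow g k j * (a · θ (pow h j)) n)
    θXᵏ-via-h a k n = begin
      (a · θ (pow X k)) n
        ≈⟨ Σ≤-cong≤ n (λ i i≤n → *-congˡ (sym (θXᵏ-coeff (n ∸ i) (ℕₚ.m∸n≤m n i)))) ⟩
      Σ≤ n (λ i → a i * Σ≤ n (λ j → pow g k j * θ (pow h j) (n ∸ i)))
        ≈⟨ Σ≤-cong n (λ i → *-distribˡ-Σ≤ n _ _) ⟩
      Σ≤ n (λ i → Σ≤ n (λ j → a i * (pow g k j * θ (pow h j) (n ∸ i))))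
        ≈⟨ Σ≤-swap n n _ ⟩
      Σ≤ n (λ j → Σ≤ n (λ i → a i * (pow g k j * θ (pow h j) (n ∸ i))))
        ≈⟨ Σ≤-cong n (λ j → trans (Σ≤-cong n (λ i → x∙yz≈y∙xz _ _ _)) (sym (*-distribˡ-Σ≤ n _ _))) ⟩
      Σ≤ n (λ j → pow g k j * (a · θ (pow h j)) n) ∎
      where
      θXᵏ-coeff : ∀ N → N ≤ n → Σ≤ n (λ j → pow g k j * θ (pow h j) N) ≈ θ (pow X k) N
      θXᵏ-coeff N N≤n = begin
        Σ≤ n (λ j → pow g k j * (fromℕ N * pow h j N)) ≈⟨ Σ≤-cong n (λ j → x∙yz≈y∙xz _ _ _) ⟩
        Σ≤ n (λ j → fromℕ N * (pow g k j * pow h j N)) ≈⟨ *-distribˡ-Σ≤ n _ _ ⟨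
        fromℕ N * Σ≤ n (λ j → pow g k j * pow h j N)   ≈⟨ *-congˡ (∘ₛ-truncate (pow g k) h h₀≈0 n N N≤n) ⟩
        fromℕ N * (pow g k ∘ₛ h) N                     ≈⟨ *-congˡ (pow-∘ₛ g h h₀≈0 k N) ⟩
        fromℕ N * pow (g ∘ₛ h) k N                     ≈⟨ *-congˡ (pow-cong k g∘h≋X N) ⟩
        θ (pow X k) N                                  ∎

    lagrange : ∀ k m → fromℕ (k + m) * pow g k (k + m) ≈ fromℕ k * pow ψ (k + m) m
    lagrange k m = begin
      fromℕ n * pow g k n                                  ≈⟨ *-comm _ _ ⟩
      pow g k n * fromℕ n                                  ≈⟨ *-congˡ ([ψⁿθhⁿ]ₙ≈n n) ⟨
      pow g k n * (pow ψ n · θ (pow h n)) n                ≈⟨ Σ≤-single n n _ ℕₚ.≤-refl (λ j j≤n j≢n →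
                                                                trans (*-congˡ ([ψⁿθhʲ]ₙ≈0 j n (ℕₚ.≤∧≢⇒< j≤n j≢n))) (zeroʳ _)) ⟨
      Σ≤ n (λ j → pow g k j * (pow ψ n · θ (pow h j)) n)  ≈⟨ θXᵏ-via-h (pow ψ n) k n ⟨
      (pow ψ n · θ (pow X k)) n                            ≈⟨ [a·θXᵏ]ₖ₊ₘ≈k*aₘ (pow ψ n) k m ⟩
      fromℕ k * pow ψ n m                                  ∎
      where
      n : ℕ
      n = k + m

  hockey-stick : ∀ q L → Σ≤ L (λ p → binom (q + p) p) ≈ binom (q + suc L) L
  hockey-stick q zero    = refl
  hockey-stick q (suc L) = begin
    Σ≤ L (λ p → binom (q + p) p) +F binom (q + suc L) (suc L)  ≈⟨ +-congʳ (hockey-stick q L) ⟩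
    binom (q + suc L) L +F binom (q + suc L) (suc L)           ≈⟨ fromℕ-+ ((q + suc L) C L) ((q + suc L) C suc L) ⟨
    fromℕ ((q + suc L) C L + (q + suc L) C suc L)              ≡⟨ ≡.cong fromℕ pascal ⟩
    binom (q + suc (suc L)) (suc L)                            ∎
    where
    pascal : (q + suc L) C L + (q + suc L) C suc L ≡ (q + suc (suc L)) C suc L
    pascal = ≡.trans (nCk+nC[k+1]≡[n+1]C[k+1] (q + suc L) L) (≡.cong (_C suc L) (≡.sym (ℕₚ.+-suc q (suc L))))

  binom-trinomial-revision : ∀ n j p →
    binom (n + (j + p)) (j + p) * binom (j + p) j ≈ binom (n + j) j * binom (n + j + p) p
  binom-trinomial-revision n j p =
    trans (sym (fromℕ-* ((n + (j + p)) C (j + p)) ((j + p) C j)))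
      (trans (reflexive (≡.cong fromℕ (Binomial.trinomial-revision n j p))) (fromℕ-* ((n + j) C j) ((n + j + p) C p)))

  1/[1+X] : PS
  1/[1+X] i = (- 1#) ^ i

  [1/[1+X]·a]₁₊ᵢ : ∀ a i → (1/[1+X] · a) (suc i) ≈ a (suc i) +F (- 1#) * (1/[1+X] · a) i
  [1/[1+X]·a]₁₊ᵢ a i = begin
    (1/[1+X] · a) (suc i)                                          ≈⟨ Σ≤-first i _ ⟩
    1# * a (suc i) +F Σ≤ i (λ l → ((- 1#) * (- 1#) ^ l) * a (i ∸ l)) ≈⟨ +-cong (*-identityˡ _)
                                                                           (trans (Σ≤-cong i (λ l → *-assoc _ _ _)) (sym (*-distribˡ-Σ≤ i _ _))) ⟩
    a (suc i) +F (- 1#) * (1/[1+X] · a) i                          ∎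

  1/[1+X]·[1+X]≋1 : (1/[1+X] · (1ₛ ⊕ X)) ≋ 1ₛ
  1/[1+X]·[1+X]≋1 zero    = trans (*-identityˡ _) (+-identityʳ _)
  1/[1+X]·[1+X]≋1 (suc i) = begin
    (1/[1+X] · (1ₛ ⊕ X)) (suc i)                   ≈⟨ [1/[1+X]·a]₁₊ᵢ (1ₛ ⊕ X) i ⟩
    (1ₛ ⊕ X) (suc i) +F (- 1#) * (1/[1+X] · (1ₛ ⊕ X)) i ≈⟨ +-cong (+-identityˡ (X (suc i))) (*-congˡ (1/[1+X]·[1+X]≋1 i)) ⟩
    X (suc i) +F (- 1#) * 1ₛ i                      ≈⟨ X₁₊ᵢ-1ₛᵢ≈0 i ⟩
    0#                                             ∎
    where
    X₁₊ᵢ-1ₛᵢ≈0 : ∀ i → X (suc i) +F (- 1#) * 1ₛ i ≈ 0#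
    X₁₊ᵢ-1ₛᵢ≈0 zero    = trans (+-congˡ (-1*x≈-x 1#)) (-‿inverseʳ 1#)
    X₁₊ᵢ-1ₛᵢ≈0 (suc i) = trans (+-identityˡ _) (zeroʳ _)

  [1/[1+X]ⁿ⁺¹]ᵢ : ∀ n i → pow 1/[1+X] (suc n) i ≈ (- 1#) ^ i * binom (n + i) i
  [1/[1+X]ⁿ⁺¹]ᵢ zero    i = trans (pow-one 1/[1+X] i)
    (sym (trans (*-congˡ (reflexive (≡.cong fromℕ (nCn≡1 i)))) (trans (*-congˡ (+-identityʳ 1#)) (*-identityʳ _))))
  [1/[1+X]ⁿ⁺¹]ᵢ (suc n) = coeff
    where
    W : PS
    W = pow 1/[1+X] (suc n)
    pascal : ∀ i → (n + suc i) C suc i + (suc n + i) C i ≡ (suc n + suc i) C suc i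
    pascal i rewrite ℕₚ.+-suc n i =
      ≡.trans (ℕₚ.+-comm (suc (n + i) C suc i) (suc (n + i) C i)) (nCk+nC[k+1]≡[n+1]C[k+1] (suc (n + i)) i)
    coeff : ∀ i → (1/[1+X] · W) i ≈ (- 1#) ^ i * binom (suc n + i) i
    coeff zero    = trans (*-identityˡ _) ([1/[1+X]ⁿ⁺¹]ᵢ n 0)
    coeff (suc i) = begin
      (1/[1+X] · W) (suc i)                                         ≈⟨ [1/[1+X]·a]₁₊ᵢ W i ⟩
      W (suc i) +F (- 1#) * (1/[1+X] · W) i                         ≈⟨ +-cong ([1/[1+X]ⁿ⁺¹]ᵢ n (suc i)) (*-congˡ (coeff i)) ⟩
      (- 1#) ^ suc i * binom (n + suc i) (suc i) +F (- 1#) * ((- 1#) ^ i * binom (suc n + i) i)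
                                                                    ≈⟨ +-congˡ (*-assoc _ _ _) ⟨
      (- 1#) ^ suc i * binom (n + suc i) (suc i) +F (- 1#) ^ suc i * binom (suc n + i) i
                                                                    ≈⟨ distribˡ _ _ _ ⟨
      (- 1#) ^ suc i * (binom (n + suc i) (suc i) +F binom (suc n + i) i)
                                                                    ≈⟨ *-congˡ (trans (sym (fromℕ-+ ((n + suc i) C suc i) ((suc n + i) C i))) (reflexive (≡.cong fromℕ (pascal i)))) ⟩
      (- 1#) ^ suc i * binom (suc n + suc i) (suc i)                ∎

  binomial-const : ∀ a x i m → pow (a ⊕ const x) i m ≈ Σ≤ i (λ j → binom i j * (x ^ (i ∸ j) * pow a j m))
  binomial-const a x i m = begin
    pow (a ⊕ const x) i m                                   ≈⟨ pow≋^ₛ (a ⊕ const x) i m ⟩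
    ((a ⊕ const x) ^ₛ i) m                                  ≈⟨ Bin.theorem i a (const x) m ⟩
    Bin.binomialExpansion a (const x) i m                   ≈⟨ sumₛ≋Σ≤ i (λ j → (i C j) ×ₛ ((a ^ₛ j) · (const x ^ₛ (i ∸ j)))) m ⟩
    Σ≤ i (λ j → ((i C j) ×ₛ ((a ^ₛ j) · (const x ^ₛ (i ∸ j)))) m) ≈⟨ Σ≤-cong i (λ j → trans (×ₛ-coeff (i C j) _ m) (*-congˡ (term j))) ⟩
    Σ≤ i (λ j → binom i j * (x ^ (i ∸ j) * pow a j m))      ∎
    where
    module Bin = BinomialTheorem seriesSemiring
    open import Algebra.Properties.Semiring.Mult S.semiring using () renaming (_×_ to _×ₛ_)
    open import Algebra.Definitions.RawMonoid S.+-rawMonoid using () renaming (sum to sumₛ)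
    ×ₛ-coeff : ∀ k s N → (k ×ₛ s) N ≈ fromℕ k * s N
    ×ₛ-coeff zero    s N = sym (zeroˡ _)
    ×ₛ-coeff (suc k) s N = trans (+-congˡ (×ₛ-coeff k s N)) (trans (+-congʳ (sym (*-identityˡ _))) (sym (distribʳ _ _ _)))
    sumₛ≋Σ≤ : ∀ n (T : ℕ → PS) → sumₛ {suc n} (λ k → T (toℕ k)) ≋ (λ N → Σ≤ n (λ j → T j N))
    sumₛ≋Σ≤ zero    T N = +-identityʳ _
    sumₛ≋Σ≤ (suc n) T N = trans (+-congˡ (sumₛ≋Σ≤ n (λ j → T (suc j)) N)) (sym (Σ≤-first n (λ j → T j N)))
    term : ∀ j → ((a ^ₛ j) · (const x ^ₛ (i ∸ j))) m ≈ x ^ (i ∸ j) * pow a j m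
    term j = trans (·-cong (≋-sym (pow≋^ₛ a j)) (≋-trans (≋-sym (pow≋^ₛ (const x) (i ∸ j))) (const-pow x (i ∸ j))) m)
                   (·const (pow a j) (x ^ (i ∸ j)) m)

  -- h = a·t·v with v = 1 + u, so ψ = b/(1 + u) is t/h.
  module ReciprocalExpansion (h : PS) (a b : Carrier) (h₀≈0 : h 0 ≈ 0#) (h₁≈a : h 1 ≈ a) (a*b≈1 : a * b ≈ 1#) where

    v u ψ : PS
    v n = b * h (suc n)
    u zero    = 0#
    u (suc n) = v (suc n)
    ψ = const b · (1/[1+X] ∘ₛ u)

    b*a≈1 : b * a ≈ 1#
    b*a≈1 = trans (*-comm b a) a*b≈1

    v≋1ₛ⊕u : v ≋ (1ₛ ⊕ u)
    v≋1ₛ⊕u zero    = trans (*-congˡ h₁≈a) (trans b*a≈1 (sym (+-identityʳ 1#)))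
    v≋1ₛ⊕u (suc n) = sym (+-identityˡ _)

    u≋v⊕const-1 : u ≋ (v ⊕ const (- 1#))
    u≋v⊕const-1 zero    = sym (trans (+-congʳ (trans (v≋1ₛ⊕u 0) (+-identityʳ 1#))) (-‿inverseʳ 1#))
    u≋v⊕const-1 (suc n) = sym (+-identityʳ _)

    h≋a·X·v : h ≋ (const a · (X · v))
    h≋a·X·v zero    = trans h₀≈0 (sym (trans (const-· a (X · v) 0) (trans (*-congˡ (zeroˡ _)) (zeroʳ a))))
    h≋a·X·v (suc n) = sym (trans (const-· a (X · v) (suc n)) (trans (*-congˡ (X·-shift v n))
                        (trans (sym (*-assoc a b _)) (trans (*-congʳ a*b≈1) (*-identityˡ _)))))

    ψ·h≋X : (ψ · h) ≋ X
    ψ·h≋X = ≋-begin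
      ψ · h                                            ≋⟨ ·-congˡ ψ h≋a·X·v ⟩
      (const b · (1/[1+X] ∘ₛ u)) · (const a · (X · v)) ≋⟨ solveₛ 5 (λ B G A x w → (B ⊠ G) ⊠ (A ⊠ (x ⊠ w)) ≐ (B ⊠ A) ⊠ (x ⊠ (G ⊠ w)))
                                                             ≋-refl (const b) (1/[1+X] ∘ₛ u) (const a) X v ⟩
      (const b · const a) · (X · ((1/[1+X] ∘ₛ u) · v)) ≋⟨ ·-cong b·a≋1 (·-congˡ X [1/[1+X]∘u]·v≋1) ⟩
      1ₛ · (X · 1ₛ)                                    ≋⟨ ≋-trans (1ₛ-· (X · 1ₛ)) (S.*-identityʳ X) ⟩
      X                                                ≋-∎
      where
      b·a≋1 : (const b · const a) ≋ 1ₛ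
      b·a≋1 = ≋-trans (≋-sym (const-* b a)) (const-cong b*a≈1)
      [1+X]∘u≋v : ((1ₛ ⊕ X) ∘ₛ u) ≋ v
      [1+X]∘u≋v = ≋-trans (⊕-∘ₛ 1ₛ X u) (≋-trans (S.+-cong (1ₛ-∘ₛ u) (X-∘ₛ u refl)) (≋-sym v≋1ₛ⊕u))
      [1/[1+X]∘u]·v≋1 : ((1/[1+X] ∘ₛ u) · v) ≋ 1ₛ
      [1/[1+X]∘u]·v≋1 = ≋-begin
        (1/[1+X] ∘ₛ u) · v                   ≋⟨ ·-congˡ (1/[1+X] ∘ₛ u) (≋-sym [1+X]∘u≋v) ⟩
        (1/[1+X] ∘ₛ u) · ((1ₛ ⊕ X) ∘ₛ u)     ≋⟨ ≋-sym (·-∘ₛ 1/[1+X] (1ₛ ⊕ X) u refl) ⟩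
        (1/[1+X] · (1ₛ ⊕ X)) ∘ₛ u            ≋⟨ ∘ₛ-congˡ u 1/[1+X]·[1+X]≋1 ⟩
        1ₛ ∘ₛ u                              ≋⟨ 1ₛ-∘ₛ u ⟩
        1ₛ                                   ≋-∎

    [ψⁿ]ₘ : ∀ n m → pow ψ n m ≈ b ^ n * Σ≤ m (λ i → pow 1/[1+X] n i * pow u i m)
    [ψⁿ]ₘ n m = begin
      pow ψ n m                                    ≈⟨ pow-distrib-· (const b) (1/[1+X] ∘ₛ u) n m ⟩
      (pow (const b) n · pow (1/[1+X] ∘ₛ u) n) m   ≈⟨ ·-cong (const-pow b n) (≋-sym (pow-∘ₛ 1/[1+X] u refl n)) m ⟩
      (const (b ^ n) · (pow 1/[1+X] n ∘ₛ u)) m     ≈⟨ const-· (b ^ n) (pow 1/[1+X] n ∘ₛ u) m ⟩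
      b ^ n * (pow 1/[1+X] n ∘ₛ u) m               ∎

    [vʲ]ₘ : ∀ j m → pow v j m ≈ b ^ j * pow h j (j + m)
    [vʲ]ₘ j m = sym (begin
      b ^ j * pow h j (j + m)       ≈⟨ *-congˡ [hʲ]ⱼ₊ₘ ⟩
      b ^ j * (a ^ j * pow v j m)   ≈⟨ *-assoc _ _ _ ⟨
      (b ^ j * a ^ j) * pow v j m   ≈⟨ *-congʳ (trans (sym (^-distrib-* b a j)) (trans (^-cong j b*a≈1) (1^n≈1 j))) ⟩
      1# * pow v j m                ≈⟨ *-identityˡ _ ⟩
      pow v j m                     ∎)
      where
      [hʲ]ⱼ₊ₘ : pow h j (j + m) ≈ a ^ j * pow v j m
      [hʲ]ⱼ₊ₘ = begin
        pow h j (j + m)                               ≈⟨ pow-cong j h≋a·X·v (j + m) ⟩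
        pow (const a · (X · v)) j (j + m)             ≈⟨ pow-distrib-· (const a) (X · v) j (j + m) ⟩
        (pow (const a) j · pow (X · v) j) (j + m)     ≈⟨ ·-cong (const-pow a j) (pow-distrib-· X v j) (j + m) ⟩
        (const (a ^ j) · (pow X j · pow v j)) (j + m) ≈⟨ const-· (a ^ j) (pow X j · pow v j) (j + m) ⟩
        a ^ j * (pow X j · pow v j) (j + m)           ≈⟨ *-congˡ (Xʲ·-shift j (pow v j) m) ⟩
        a ^ j * pow v j m                             ∎

    [uⁱ]ₘ : ∀ i m → pow u i m ≈ Σ≤ i (λ j → binom i j * ((- 1#) ^ (i ∸ j) * pow v j m))
    [uⁱ]ₘ i m = trans (pow-cong i u≋v⊕const-1 m) (binomial-const v (- 1#) i m)

    ψ-expansion : ∀ n m → pow ψ (suc n) m ≈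
      b ^ suc n * Σ≤ m (λ j → ((- 1#) ^ j * (b ^ j * pow h j (j + m))) * (binom (n + j) j * binom (m + suc n) (m ∸ j)))
    ψ-expansion n m = begin
      pow ψ (suc n) m
        ≈⟨ [ψⁿ]ₘ (suc n) m ⟩
      b ^ suc n * Σ≤ m (λ i → pow 1/[1+X] (suc n) i * pow u i m)
        ≈⟨ *-congˡ (Σ≤-cong m (λ i → *-cong ([1/[1+X]ⁿ⁺¹]ᵢ n i)
             (trans ([uⁱ]ₘ i m) (Σ≤-cong i (λ j → *-congˡ (*-congˡ ([vʲ]ₘ j m))))))) ⟩
      b ^ suc n * Σ≤ m (λ i → ((- 1#) ^ i * binom (n + i) i) * Σ≤ i (T′ i))
        ≈⟨ *-congˡ (Σ≤-cong m (λ i → *-distribˡ-Σ≤ i _ (T′ i))) ⟩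
      b ^ suc n * Σ≤ m (λ i → Σ≤ i (T i))
        ≈⟨ *-congˡ (Σ≤-cong≤ m (λ i i≤m → Σ≤-cong≤ i (λ j j≤i → reflexive (≡.cong (λ q → T q j) (≡.sym (ℕₚ.m+[n∸m]≡n j≤i)))))) ⟩
      b ^ suc n * Σ≤ m (λ i → Σ≤ i (λ j → T (j + (i ∸ j)) j))
        ≈⟨ *-congˡ (Σ≤-triangle m (λ j p → T (j + p) j)) ⟩
      b ^ suc n * Σ≤ m (λ j → Σ≤ (m ∸ j) (λ p → T (j + p) j))
        ≈⟨ *-congˡ (Σ≤-cong≤ m collapse) ⟩
      b ^ suc n * Σ≤ m (λ j → ((- 1#) ^ j * V j) * (binom (n + j) j * binom (m + suc n) (m ∸ j))) ∎
      where
      V : ℕ → Carrier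
      V j = b ^ j * pow h j (j + m)
      T′ T : ℕ → ℕ → Carrier
      T′ i j = binom i j * ((- 1#) ^ (i ∸ j) * V j)
      T i j = ((- 1#) ^ i * binom (n + i) i) * T′ i j
      T[j+p]j : ∀ j p → T (j + p) j ≈ ((- 1#) ^ j * V j) * (binom (n + j) j * binom (n + j + p) p)
      T[j+p]j j p = begin
        (s ^ (j + p) * A) * (B * (s ^ (j + p ∸ j) * V j))
          ≈⟨ *-cong (*-congʳ (^-+ s j p)) (*-congˡ (*-congʳ (reflexive (≡.cong (s ^_) (ℕₚ.m+n∸m≡n j p))))) ⟩
        ((s ^ j * s ^ p) * A) * (B * (s ^ p * V j))
          ≈⟨ solve 5 (λ x y a b w → ((x :* y) :* a) :* (b :* (y :* w)) := (x :* w) :* ((y :* y) :* (a :* b))) refl (s ^ j) (s ^ p) A B (V j) ⟩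
        (s ^ j * V j) * ((s ^ p * s ^ p) * (A * B))
          ≈⟨ *-congˡ (*-cong (trans (sym (^-+ s p p)) (-1^[p+p]≈1 p)) (binom-trinomial-revision n j p)) ⟩
        (s ^ j * V j) * (1# * (binom (n + j) j * binom (n + j + p) p))
          ≈⟨ *-congˡ (*-identityˡ _) ⟩
        (s ^ j * V j) * (binom (n + j) j * binom (n + j + p) p) ∎
        where
        s A B : Carrier
        s = - 1#
        A = binom (n + (j + p)) (j + p)
        B = binom (j + p) j
      collapse : ∀ j → j ≤ m →
        Σ≤ (m ∸ j) (λ p → T (j + p) j) ≈ ((- 1#) ^ j * V j) * (binom (n + j) j * binom (m + suc n) (m ∸ j))
      collapse j j≤m = begin
        Σ≤ (m ∸ j) (λ p → T (j + p) j)                      ≈⟨ Σ≤-cong (m ∸ j) (T[j+p]j j) ⟩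
        Σ≤ (m ∸ j) (λ p → Z * (B * binom (n + j + p) p))     ≈⟨ Σ≤-cong (m ∸ j) (λ p → sym (*-assoc _ _ _)) ⟩
        Σ≤ (m ∸ j) (λ p → (Z * B) * binom (n + j + p) p)     ≈⟨ *-distribˡ-Σ≤ (m ∸ j) _ _ ⟨
        (Z * B) * Σ≤ (m ∸ j) (λ p → binom (n + j + p) p)     ≈⟨ *-congˡ (hockey-stick (n + j) (m ∸ j)) ⟩
        (Z * B) * binom (n + j + suc (m ∸ j)) (m ∸ j)        ≡⟨ ≡.cong (λ q → (Z * B) * binom q (m ∸ j)) n+j+[1+m∸j]≡m+[1+n] ⟩
        (Z * B) * binom (m + suc n) (m ∸ j)                  ≈⟨ *-assoc _ _ _ ⟩
        Z * (B * binom (m + suc n) (m ∸ j))                  ∎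
        where
        Z B : Carrier
        Z = (- 1#) ^ j * V j
        B = binom (n + j) j
        rearrange : ∀ n j d → n + j + suc d ≡ j + d + suc n
        rearrange = solve-∀
        n+j+[1+m∸j]≡m+[1+n] : n + j + suc (m ∸ j) ≡ m + suc n
        n+j+[1+m∸j]≡m+[1+n] = ≡.trans (rearrange n j (m ∸ j)) (≡.cong (_+ suc n) (ℕₚ.m+[n∸m]≡n j≤m))

  fact-ratio-step : ∀ n k {x y} → fromℕ (suc n) * x ≈ fromℕ (suc k) * y →
    fact (suc n) * (inv (fact (suc k)) * x) ≈ fact n * (inv (fact k) * y)
  fact-ratio-step n k {x} {y} [n+1]x≈[k+1]y = *-cancelˡ (fact≉0 (suc k)) (begin
    fact (suc k) * (fact (suc n) * (inv (fact (suc k)) * x))  ≈⟨ x∙yz≈y∙xz _ _ _ ⟩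
    fact (suc n) * (fact (suc k) * (inv (fact (suc k)) * x))  ≈⟨ *-congˡ (inv-cancelˡ x (fact≉0 (suc k))) ⟩
    fact (suc n) * x                                          ≈⟨ *-congʳ (fact-suc n) ⟩
    fromℕ (suc n) * fact n * x                                ≈⟨ xy∙z≈y∙xz _ _ _ ⟩
    fact n * (fromℕ (suc n) * x)                              ≈⟨ *-congˡ [n+1]x≈[k+1]y ⟩
    fact n * (fromℕ (suc k) * y)                              ≈⟨ *-congˡ (*-congˡ (inv-cancelˡ y (fact≉0 k))) ⟨
    fact n * (fromℕ (suc k) * (fact k * (inv (fact k) * y)))  ≈⟨ solve 4 (λ f s K z → f :* (s :* (K :* z)) := (s :* K) :* (f :* z)) refl _ _ _ _ ⟩
    fromℕ (suc k) * fact k * (fact n * (inv (fact k) * y))    ≈⟨ *-congʳ (fact-suc k) ⟨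
    fact (suc k) * (fact n * (inv (fact k) * y))              ∎)

  binom-factorial-exchange : ∀ k m j →
    fact (k + m) * binom (k + m + j) j * inv (fact k) ≈ binom (k + m + j) (m + j) * fact (m + j) * inv (fact j)
  binom-factorial-exchange k m j = cross-multiply (fact≉0 k) (fact≉0 j) (begin
    fact (k + m) * binom N j * fact j             ≈⟨ *-congʳ (fromℕ-* ((k + m) Nat.!) (N C j)) ⟨
    fromℕ ((k + m) Nat.! Nat.* (N C j)) * fact j  ≈⟨ fromℕ-* ((k + m) Nat.! Nat.* (N C j)) (j Nat.!) ⟨
    fromℕ ((k + m) Nat.! Nat.* (N C j) Nat.* j Nat.!)
      ≡⟨ ≡.cong fromℕ (Binomial.[k+m]!*[k+m+j]Cj*j!≡k!*[k+m+j]C[m+j]*[m+j]! k m j) ⟩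
    fromℕ (k Nat.! Nat.* ((N C (m + j)) Nat.* (m + j) Nat.!))
      ≈⟨ fromℕ-* (k Nat.!) ((N C (m + j)) Nat.* (m + j) Nat.!) ⟩
    fact k * fromℕ ((N C (m + j)) Nat.* (m + j) Nat.!) ≈⟨ *-congˡ (fromℕ-* (N C (m + j)) ((m + j) Nat.!)) ⟩
    fact k * (binom N (m + j) * fact (m + j))     ∎)
    where
    N : ℕ
    N = k + m + j

  ∘ₛ≋X⇒[g]₁≉0 : ∀ {f g} → (f ∘ₛ g) ≋ X → g 1 ≉ 0#
  ∘ₛ≋X⇒[g]₁≉0 {f} {g} f∘g≋X g₁≈0 = 1≉0 (begin
    1#                           ≈⟨ f∘g≋X 1 ⟨
    f 0 * 0# +F f 1 * pow g 1 1  ≈⟨ +-cong (zeroʳ _) (trans (*-congˡ (trans (pow-one g 1) g₁≈0)) (zeroʳ _)) ⟩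
    0# +F 0#                     ≈⟨ +-identityʳ 0# ⟩
    0#                           ∎)

  module Stirling (fbar ebar : PS) (fbar₁≉0 : fbar 1 ≉ 0#) (ebar∘h≋X : (ebar ∘ₛ expm1∘ fbar) ≋ X) where

    h : PS
    h = expm1∘ fbar

    b : Carrier
    b = inv (fbar 1)

    h₁≈fbar₁ : h 1 ≈ fbar 1
    h₁≈fbar₁ = begin
      0# * 0# +F inv (fact 1) * pow fbar 1 1  ≈⟨ +-cong (zeroˡ 0#) (*-cong inv[1]≈1 (pow-one fbar 1)) ⟩
      0# +F 1# * fbar 1                       ≈⟨ trans (+-identityˡ _) (*-identityˡ _) ⟩
      fbar 1                                  ∎
      where
      inv[1]≈1 : inv (fact 1) ≈ 1#
      inv[1]≈1 = trans (sym (*-identityˡ _)) (trans (*-congʳ (sym (+-identityʳ 1#))) (inv-law (fact 1) (fact≉0 1)))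

    open ReciprocalExpansion h (fbar 1) b (zeroˡ _) h₁≈fbar₁ (inv-law (fbar 1) fbar₁≉0) using (ψ; ψ·h≋X; ψ-expansion)
    open LagrangeInversion h ψ ebar (zeroˡ _) ψ·h≋X ebar∘h≋X using (lagrange)

    dualityTerm : (p q r s e t j : ℕ) → Carrier
    dualityTerm p q r s e t j = binom p q * (binom r s * ((- 1#) ^ j * (b ^ e * S₂ fbar t j)))

    dualitySum : ℕ → ℕ → Carrier
    dualitySum n k = Σ≤ (n ∸ k) (λ j → dualityTerm (n + j ∸ 1) (n + j ∸ k) (n + n ∸ k) (n ∸ k ∸ j) (n + j) (n ∸ k + j) j)

    duality-term : ∀ k m j →
      fact (k + m) * (inv (fact k) * (b ^ suc (k + m) *
        (((- 1#) ^ j * (b ^ j * pow h j (j + m))) * (binom (k + m + j) j * binom (m + suc (k + m)) (m ∸ j)))))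
      ≈ dualityTerm (k + m + j) (m + j) (m + suc (k + m)) (m ∸ j) (suc (k + m) + j) (m + j) j
    duality-term k m j = begin
      Fk+m * (IK * (b ^ n * ((S * (b ^ j * H)) * (Cⱼ * D))))
        ≈⟨ solve 8 (λ F IK bn S bj H Cj D → F :* (IK :* (bn :* ((S :* (bj :* H)) :* (Cj :* D))))
                                          := (F :* Cj :* IK) :* (D :* (S :* ((bn :* bj) :* H)))) refl Fk+m IK (b ^ n) S (b ^ j) H Cⱼ D ⟩
      (Fk+m * Cⱼ * IK) * (D * (S * ((b ^ n * b ^ j) * H)))
        ≈⟨ *-cong (binom-factorial-exchange k m j)
                  (*-congˡ (*-congˡ (*-cong (sym (^-+ b n j)) (reflexive (≡.cong (pow h j) (ℕₚ.+-comm j m)))))) ⟩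
      (binom (k + m + j) (m + j) * fact (m + j) * inv (fact j)) * (D * (S * (b ^ (n + j) * pow h j (m + j))))
        ≈⟨ solve 7 (λ L Fm IJ D S bnj H → (L :* Fm :* IJ) :* (D :* (S :* (bnj :* H)))
                                       := L :* (D :* (S :* (bnj :* (Fm :* (IJ :* H))))))
                   refl (binom (k + m + j) (m + j)) (fact (m + j)) (inv (fact j)) D S (b ^ (n + j)) (pow h j (m + j)) ⟩
      dualityTerm (k + m + j) (m + j) (m + n) (m ∸ j) (n + j) (m + j) j ∎
      where
      n : ℕ
      n = suc (k + m)
      Fk+m IK S H Cⱼ D : Carrier
      Fk+m = fact (k + m)
      IK = inv (fact k)
      S = (- 1#) ^ j
      H = pow h j (j + m)
      Cⱼ = binom (k + m + j) j
      D = binom (m + n) (m ∸ j)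

    S₁-positive : ∀ k m → S₁ ebar (suc k + m) (suc k) ≈
      Σ≤ m (λ j → dualityTerm (k + m + j) (m + j) (m + suc (k + m)) (m ∸ j) (suc (k + m) + j) (m + j) j)
    S₁-positive k m = begin
      S₁ ebar n (suc k)                                               ≈⟨ fact-ratio-step (k + m) k (lagrange (suc k) m) ⟩
      fact (k + m) * (inv (fact k) * pow ψ n m)                       ≈⟨ *-congˡ (*-congˡ (ψ-expansion (k + m) m)) ⟩
      fact (k + m) * (inv (fact k) * (b ^ n * Σ≤ m T))                ≈⟨ *-congˡ (*-congˡ (*-distribˡ-Σ≤ m _ T)) ⟩
      fact (k + m) * (inv (fact k) * Σ≤ m (λ j → b ^ n * T j))        ≈⟨ *-congˡ (*-distribˡ-Σ≤ m _ _) ⟩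
      fact (k + m) * Σ≤ m (λ j → inv (fact k) * (b ^ n * T j))        ≈⟨ *-distribˡ-Σ≤ m _ _ ⟩
      Σ≤ m (λ j → fact (k + m) * (inv (fact k) * (b ^ n * T j)))      ≈⟨ Σ≤-cong m (duality-term k m) ⟩
      Σ≤ m (λ j → dualityTerm (k + m + j) (m + j) (m + n) (m ∸ j) (n + j) (m + j) j) ∎
      where
      n : ℕ
      n = suc (k + m)
      T : ℕ → Carrier
      T j = ((- 1#) ^ j * (b ^ j * pow h j (j + m))) * (binom (k + m + j) j * binom (m + n) (m ∸ j))

    dualitySum-reindex : ∀ k m →
      Σ≤ m (λ j → dualityTerm (k + m + j) (m + j) (m + suc (k + m)) (m ∸ j) (suc (k + m) + j) (m + j) j)
      ≈ dualitySum (suc k + m) (suc k)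
    dualitySum-reindex k m = begin
      Σ≤ m (λ j → dualityTerm (k + m + j) (m + j) (m + n) (m ∸ j) (n + j) (m + j) j)
        ≈⟨ Σ≤-cong m (λ j → reflexive (dualityTerm-cong (k + m + j) (n + j) j
             (≡.sym (k+m+i∸k≡m+i j)) (≡.sym (k+m+i∸k≡m+i n)) (≡.cong (_∸ j) (≡.sym n∸[1+k]≡m)) (≡.cong (_+ j) (≡.sym n∸[1+k]≡m)))) ⟩
      Σ≤ m summand
        ≡⟨ ≡.cong (λ q → Σ≤ q summand) n∸[1+k]≡m ⟨
      dualitySum n (suc k) ∎
      where
      n : ℕ
      n = suc (k + m)
      summand : ℕ → Carrier
      summand j = dualityTerm (n + j ∸ 1) (n + j ∸ suc k) (n + n ∸ suc k) (n ∸ suc k ∸ j) (n + j) (n ∸ suc k + j) j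
      n∸[1+k]≡m : n ∸ suc k ≡ m
      n∸[1+k]≡m = ℕₚ.m+n∸m≡n k m
      k+m+i∸k≡m+i : ∀ i → k + m + i ∸ k ≡ m + i
      k+m+i∸k≡m+i i = ≡.trans (≡.cong (_∸ k) (ℕₚ.+-assoc k m i)) (ℕₚ.m+n∸m≡n k (m + i))
      dualityTerm-cong : ∀ {q q′ r r′ s s′ t t′} p e j → q ≡ q′ → r ≡ r′ → s ≡ s′ → t ≡ t′ →
        dualityTerm p q r s e t j ≡ dualityTerm p q′ r′ s′ e t′ j
      dualityTerm-cong p e j ≡.refl ≡.refl ≡.refl ≡.refl = ≡.refl

    duality-at-zero : ∀ n → S₁ ebar n 0 ≈ dualitySum n 0
    duality-at-zero zero    = trans (inv-cancelˡ 1# (fact≉0 0)) (sym (begin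
      binom 0 0 * (binom 0 0 * (1# * (1# * S₂ fbar 0 0)))  ≈⟨ *-cong 1+0≈1 (*-cong 1+0≈1 (trans (*-identityˡ _) (trans (*-identityˡ _) (inv-cancelˡ 1# (fact≉0 0))))) ⟩
      1# * (1# * 1#)                                       ≈⟨ trans (*-identityˡ _) (*-identityˡ _) ⟩
      1#                                                   ∎))
      where
      1+0≈1 : 1# +F 0# ≈ 1#
      1+0≈1 = +-identityʳ 1#
    duality-at-zero (suc n) = trans (trans (*-congˡ (zeroʳ _)) (zeroʳ _)) (sym (Σ≤-≈0 (suc n) _ (λ j _ →
      trans (*-congʳ (reflexive (≡.cong fromℕ (k>n⇒nCk≡0 (ℕₚ.n<1+n (n + j)))))) (zeroˡ _))))

    duality : ∀ n k → k ≤ n → S₁ ebar n k ≈ dualitySum n k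
    duality n zero    _   = duality-at-zero n
    duality n (suc k) k<n = ≡.subst (λ n → S₁ ebar n (suc k) ≈ dualitySum n (suc k)) (ℕₚ.m+[n∸m]≡n k<n)
      (trans (S₁-positive k (n ∸ suc k)) (dualitySum-reindex k (n ∸ suc k)))

theorem2p7 : ∀ {c ℓ} (F : CharZeroField c ℓ) →
    let open FieldOps F in
    let open PowerSeries F in
    (f fbar ebar : PS) →
    IsDelta f → IsCompInverse f fbar →
    IsCompInverse (expm1∘ fbar) ebar →
    (n k : ℕ) → k ≤ n →
    S₁ ebar n k ≈
      Σ≤ (n ∸ k) (λ j →
        binom (n + j ∸ 1) (n + j ∸ k) * (binom (n + n ∸ k) (n ∸ k ∸ j)
          * ((- 1#) ^ j * ((inv (fbar 1)) ^ (n + j) * S₂ fbar (n ∸ k + j) j))))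
theorem2p7 F f fbar ebar _ (f∘fbar≋X , _) (_ , ebar∘h≋X) =
  Stirling.duality F fbar ebar (∘ₛ≋X⇒[g]₁≉0 F {f} f∘fbar≋X) ebar∘h≋X
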